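{- Let $b\ge2$ and $n\ge2$ be integers, and let $(\kappa_r)_{r\ge0}$ be a Markov chain on $\{0,1,\dots,n-1\}$ with transition matrix $$M(i,j)=\frac1{b^n}\sum_{l=0}^{j-\lfloor i/b\rfloor}(-1)^l\binom{n+1}{l}\binom{n-1-i+(j+1-l)b}{n},$$ started at $\kappa_0=0$. Then for all integers $r,s\ge0$: (1) $E(\kappa_r)=\left(1-\frac1{b^r}\right)\frac{n-1}{2}$; (2) $\operatorname{Var}(\kappa_r)=\left(1-\frac1{b^{2r}}\right)\frac{n+1}{12}$; (3) $\operatorname{Cov}(\kappa_s,\kappa_{s+r})=\frac1{b^r}\cdot\frac{n+1}{12}\left(1-\frac1{b^{2s}}\right)$.
   Context: $M$ is the transition matrix of the carries process when $n$ numbers with independent uniform base-$b$ digits are added in the usual way; $\kappa_r$ is the carry from column $r-1$ into column $r$, with no initial carry. -}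

module Defs where

open import Data.Nat as ℕ using (ℕ; zero; suc; _∸_; _<?_; NonZero)
open import Data.Nat.Properties using (m^n≢0)
open import Data.Nat.Combinatorics using (_C_)
open import Data.Integer as ℤ using (ℤ; +_)
open import Data.Rational as ℚ using (ℚ; _/_)
open import Data.List using (List; upTo; foldr; map)
open import Relation.Nullary using (yes; no)

Σℚ : List ℕ → (ℕ → ℚ) → ℚ
Σℚ xs f = foldr (λ x acc → f x ℚ.+ acc) ℚ.0ℚ xs
Σℤ : List ℕ → (ℕ → ℤ) → ℤ
Σℤ xs f = foldr (λ x acc → f x ℤ.+ acc) (+ 0) xs

ℕ→ℚ : ℕ → ℚ
ℕ→ℚ k = + k / 1

sgn : ℕ → ℤ
sgn zero = + 1
sgn (suc l) = ℤ.- sgn l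

Mnum : (b n : ℕ) → .{{_ : NonZero b}} → ℕ → ℕ → ℤ
Mnum b n i j with j <? i ℕ./ b
... | yes _ = + 0
... | no _  = Σℤ (upTo (suc (j ∸ i ℕ./ b)))
                 (λ l → sgn l ℤ.* (+ ((suc n) C l))
                          ℤ.* (+ (((n ∸ 1 ∸ i) ℕ.+ (suc j ∸ l) ℕ.* b) C n)))

M : (b n : ℕ) → .{{_ : NonZero b}} → ℕ → ℕ → ℚ
M b n i j = _/_ (Mnum b n i j) (b ℕ.^ n) {{m^n≢0 b n}}

Mpow : (b n : ℕ) → .{{_ : NonZero b}} → ℕ → ℕ → ℕ → ℚ
Mpow b n zero i j with i ℕ.≟ j
... | yes _ = ℚ.1ℚ
... | no _  = ℚ.0ℚ
Mpow b n (suc r) i j = Σℚ (upTo n) (λ k → Mpow b n r i k ℚ.* M b n k j)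

-- P(κ_r = j) for the chain started at κ_0 = 0
P : (b n : ℕ) → .{{_ : NonZero b}} → ℕ → ℕ → ℚ
P b n r j = Mpow b n r 0 j

E : (b n : ℕ) → .{{_ : NonZero b}} → ℕ → ℚ
E b n r = Σℚ (upTo n) (λ j → P b n r j ℚ.* ℕ→ℚ j)

Ejoint : (b n : ℕ) → .{{_ : NonZero b}} → ℕ → ℕ → ℚ
Ejoint b n s r = Σℚ (upTo n) (λ i → Σℚ (upTo n) (λ j →
                   P b n s i ℚ.* Mpow b n r i j ℚ.* ℕ→ℚ i ℚ.* ℕ→ℚ j))

Cov : (b n : ℕ) → .{{_ : NonZero b}} → ℕ → ℕ → ℚ
Cov b n s r = Ejoint b n s r ℚ.- E b n s ℚ.* E b n (s ℕ.+ r)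

Var : (b n : ℕ) → .{{_ : NonZero b}} → ℕ → ℚ
Var b n r = Σℚ (upTo n) (λ j → P b n r j ℚ.* ℕ→ℚ j ℚ.* ℕ→ℚ j)
            ℚ.- E b n r ℚ.* E b n r

invPow : (b r : ℕ) → .{{_ : NonZero b}} → ℚ
invPow b r = _/_ (+ 1) (b ℕ.^ r) {{m^n≢0 b r}}

-- A column receiving carry i passes on ⌊(i + D)/b⌋, where D is a sum of n
-- independent uniform digits.  The proof has three steps.
-- 1. Identifying M.  By inclusion–exclusion, bⁿ M(i,j) is the number of digit
--    tuples d ∈ [0,b)ⁿ with ⌊(i + Σd)/b⌋ = j (Mnum-counts); hence
--    Σ_j M(i,j) w(j) = b⁻ⁿ Σ_d w(⌊(i + Σd)/b⌋) for every weight w (M-moment).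
-- 2. Rows of M.  Summing out one digit with Hermite's identity
--    Σ_{d<b} ⌊(t+d)/b⌋ = t (and its analogue for squares), and using the mean
--    (b-1)/2 and variance (b²-1)/12 of the remaining digits, row i of M has
--    mean y·i + μ(1-y) and variance v(1-y²), where y = 1/b, μ = (n-1)/2 and
--    v = (n+1)/12 (M-row-sum, M-row-mean, M-row-square).
-- 3. Any Markov chain with rows of this shape, started at 0 (module
--    AffineChain), has E κ_r = (1-yʳ)μ, Var κ_r = (1-y²ʳ)v and
--    Cov(κ_s, κ_{s+r}) = yʳ v (1-y²ˢ): condition on the last step and induct.
-- The theorem instantiates step 3 with the rows computed in step 2.
module Submission where

open import Defs
open import Data.Nat as N using (ℕ; zero; suc; _≤_; _<_; NonZero; _+_; _*_; _∸_; z≤n; s≤s)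
import Data.Nat.Properties as NP
import Data.Nat.DivMod as DM
open import Data.Nat.Combinatorics using (_C_; nCn≡1; k>n⇒nCk≡0; nCk+nC[k+1]≡[n+1]C[k+1])
open import Data.Integer as Z using (ℤ; +_)
import Data.Integer.Properties as ZP
open import Data.Rational as Q using (ℚ; _/_; 1ℚ; 0ℚ; _-_) renaming (_*_ to _*ℚ_)
import Data.Rational.Properties as QP
import Data.Rational.Unnormalised as U
import Data.Rational.Unnormalised.Properties as UP
open import Data.Rational.Solver using (module +-*-Solver)
open import Data.List using (upTo; applyUpTo; []; _∷_)
open import Data.Product using (_×_; _,_; proj₁; proj₂)
open import Data.Sum using (inj₁; inj₂)
open import Data.Empty using (⊥-elim)
open import Function using (_∘_)
open import Relation.Nullary using (yes; no)
open import Relation.Binary.PropositionalEquality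
open ≡-Reasoning
open +-*-Solver

-- Embedding ℤ and ℕ into ℚ.  Both embeddings are ring homomorphisms; we
-- obtain this by passing through unnormalised rationals, where the
-- operations are computed without gcd normalisation.
ℤ→ℚ : ℤ → ℚ
ℤ→ℚ z = z / 1

fromℚᵘ-* : ∀ u v → Q.fromℚᵘ u Q.* Q.fromℚᵘ v ≡ Q.fromℚᵘ (u U.* v)
fromℚᵘ-* u v = trans (sym (QP.fromℚᵘ-toℚᵘ _))
  (QP.fromℚᵘ-cong (UP.≃-trans (QP.toℚᵘ-homo-* (Q.fromℚᵘ u) (Q.fromℚᵘ v))
                   (UP.*-cong (QP.toℚᵘ-fromℚᵘ u) (QP.toℚᵘ-fromℚᵘ v))))

fromℚᵘ-+ : ∀ u v → Q.fromℚᵘ u Q.+ Q.fromℚᵘ v ≡ Q.fromℚᵘ (u U.+ v)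
fromℚᵘ-+ u v = trans (sym (QP.fromℚᵘ-toℚᵘ _))
  (QP.fromℚᵘ-cong (UP.≃-trans (QP.toℚᵘ-homo-+ (Q.fromℚᵘ u) (Q.fromℚᵘ v))
                   (UP.+-cong (QP.toℚᵘ-fromℚᵘ u) (QP.toℚᵘ-fromℚᵘ v))))

ℤ→ℚ-* : ∀ x y → ℤ→ℚ (x Z.* y) ≡ ℤ→ℚ x Q.* ℤ→ℚ y
ℤ→ℚ-* x y = sym (fromℚᵘ-* (U.mkℚᵘ x 0) (U.mkℚᵘ y 0))

ℤ→ℚ-+ : ∀ x y → ℤ→ℚ (x Z.+ y) ≡ ℤ→ℚ x Q.+ ℤ→ℚ y
ℤ→ℚ-+ x y = sym (trans (fromℚᵘ-+ (U.mkℚᵘ x 0) (U.mkℚᵘ y 0))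
  (QP./-cong (cong₂ Z._+_ (ZP.*-identityʳ x) (ZP.*-identityʳ y)) refl))

ℤ→ℚ-neg : ∀ x → ℤ→ℚ (Z.- x) ≡ Q.- ℤ→ℚ x
ℤ→ℚ-neg x = sym (trans (sym (QP.fromℚᵘ-toℚᵘ _))
  (QP.fromℚᵘ-cong (UP.≃-trans (QP.toℚᵘ-homo‿- (ℤ→ℚ x))
                               (UP.-‿cong (QP.toℚᵘ-fromℚᵘ (U.mkℚᵘ x 0))))))

ℕ→ℚ-+ : ∀ a c → ℕ→ℚ (a + c) ≡ ℕ→ℚ a Q.+ ℕ→ℚ c
ℕ→ℚ-+ a c = ℤ→ℚ-+ (+ a) (+ c)

ℕ→ℚ-* : ∀ a c → ℕ→ℚ (a * c) ≡ ℕ→ℚ a Q.* ℕ→ℚ c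
ℕ→ℚ-* a c = trans (cong ℤ→ℚ (ZP.pos-* a c)) (ℤ→ℚ-* (+ a) (+ c))

ℕ→ℚ-∸ : ∀ a c → c ≤ a → ℕ→ℚ (a ∸ c) ≡ ℕ→ℚ a Q.- ℕ→ℚ c
ℕ→ℚ-∸ a c c≤a = begin
  ℕ→ℚ (a ∸ c)                         ≡⟨ solve 2 (λ x y → x := (x :+ y) :- y) refl (ℕ→ℚ (a ∸ c)) (ℕ→ℚ c) ⟩
  ℕ→ℚ (a ∸ c) Q.+ ℕ→ℚ c Q.- ℕ→ℚ c    ≡⟨ cong (Q._- ℕ→ℚ c) (sym (ℕ→ℚ-+ (a ∸ c) c)) ⟩
  ℕ→ℚ (a ∸ c + c) Q.- ℕ→ℚ c           ≡⟨ cong (λ x → ℕ→ℚ x Q.- ℕ→ℚ c) (NP.m∸n+n≡m c≤a) ⟩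
  ℕ→ℚ a Q.- ℕ→ℚ c                     ∎

/-as-* : ∀ z d .{{_ : NonZero d}} → z / d ≡ ℤ→ℚ z Q.* (+ 1 / d)
/-as-* z (suc d) = sym (trans (fromℚᵘ-* (U.mkℚᵘ z 0) (U.mkℚᵘ (+ 1) d))
  (QP./-cong (ZP.*-identityʳ z) (NP.+-identityʳ (suc d))))

1/-* : ∀ a c .{{_ : NonZero a}} .{{_ : NonZero c}} .{{_ : NonZero (a * c)}} →
       + 1 / (a * c) ≡ (+ 1 / a) Q.* (+ 1 / c)
1/-* (suc a) (suc c) = sym (fromℚᵘ-* (U.mkℚᵘ (+ 1) a) (U.mkℚᵘ (+ 1) c))

ℕ→ℚ-*-1/ : ∀ a .{{_ : NonZero a}} → ℕ→ℚ a Q.* (+ 1 / a) ≡ 1ℚ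
ℕ→ℚ-*-1/ (suc a) = trans (fromℚᵘ-* (U.mkℚᵘ (+ suc a) 0) (U.mkℚᵘ (+ 1) a))
  (QP.fromℚᵘ-cong {U.mkℚᵘ (+ suc a) 0 U.* U.mkℚᵘ (+ 1) a} {U.mkℚᵘ (+ 1) 0}
     (U.*≡* (begin
        (+ suc a Z.* + 1) Z.* + 1 ≡⟨ ZP.*-identityʳ _ ⟩
        + suc a Z.* + 1           ≡⟨ ZP.*-identityʳ _ ⟩
        + suc a                   ≡⟨ cong (λ k → + suc k) (sym (NP.+-identityʳ a)) ⟩
        + suc (a + 0)             ≡⟨ sym (ZP.*-identityˡ _) ⟩
        + 1 Z.* + suc (a + 0)     ∎)))

pow : ℚ → ℕ → ℚ
pow x zero    = 1ℚ
pow x (suc k) = x Q.* pow x k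

pow-+ : ∀ x a c → pow x (a + c) ≡ pow x a Q.* pow x c
pow-+ x zero    c = sym (QP.*-identityˡ (pow x c))
pow-+ x (suc a) c = trans (cong (x Q.*_) (pow-+ x a c)) (sym (QP.*-assoc x (pow x a) (pow x c)))

1/^ : ∀ b .{{nz : NonZero b}} k → _/_ (+ 1) (b N.^ k) {{NP.m^n≢0 b k}} ≡ pow (+ 1 / b) k
1/^ b zero    = refl
1/^ b {{nz}} (suc k) = trans (1/-* b (b N.^ k) {{nz}} {{NP.m^n≢0 b k}} {{NP.m^n≢0 b (suc k)}})
                      (cong ((+ 1 / b) Q.*_) (1/^ b k))

pow-inverse : ∀ x z → x Q.* z ≡ 1ℚ → ∀ k → pow x k Q.* pow z k ≡ 1ℚ
pow-inverse x z xz≡1 zero    = refl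
pow-inverse x z xz≡1 (suc k) = begin
  x Q.* pow x k Q.* (z Q.* pow z k)
    ≡⟨ solve 4 (λ x p z q → x :* p :* (z :* q) := (x :* z) :* (p :* q)) refl x (pow x k) z (pow z k) ⟩
  (x Q.* z) Q.* (pow x k Q.* pow z k) ≡⟨ cong₂ Q._*_ xz≡1 (pow-inverse x z xz≡1 k) ⟩
  1ℚ                                  ∎

∑ : ℕ → (ℕ → ℚ) → ℚ
∑ zero    f = 0ℚ
∑ (suc n) f = f 0 Q.+ ∑ n (f ∘ suc)

Σℚ-applyUpTo : ∀ n (g : ℕ → ℕ) f → Σℚ (applyUpTo g n) f ≡ ∑ n (f ∘ g)
Σℚ-applyUpTo zero    g f = refl
Σℚ-applyUpTo (suc n) g f = cong (f (g 0) Q.+_) (Σℚ-applyUpTo n (g ∘ suc) f)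

Σℚ-upTo : ∀ n f → Σℚ (upTo n) f ≡ ∑ n f
Σℚ-upTo n f = Σℚ-applyUpTo n (λ k → k) f

ℤ→ℚ-Σℤ : ∀ xs f → ℤ→ℚ (Σℤ xs f) ≡ Σℚ xs (ℤ→ℚ ∘ f)
ℤ→ℚ-Σℤ []       f = refl
ℤ→ℚ-Σℤ (x ∷ xs) f = trans (ℤ→ℚ-+ (f x) (Σℤ xs f)) (cong (ℤ→ℚ (f x) Q.+_) (ℤ→ℚ-Σℤ xs f))

∑-cong : ∀ n {f g : ℕ → ℚ} → (∀ k → k < n → f k ≡ g k) → ∑ n f ≡ ∑ n g
∑-cong zero    h = refl
∑-cong (suc n) h = cong₂ Q._+_ (h 0 (s≤s z≤n)) (∑-cong n (λ k k<n → h (suc k) (s≤s k<n)))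

∑-ext : ∀ n {f g : ℕ → ℚ} → (∀ k → f k ≡ g k) → ∑ n f ≡ ∑ n g
∑-ext n h = ∑-cong n (λ k _ → h k)

∑-+ : ∀ n f g → ∑ n (λ k → f k Q.+ g k) ≡ ∑ n f Q.+ ∑ n g
∑-+ zero    f g = refl
∑-+ (suc n) f g = begin
  (f 0 Q.+ g 0) Q.+ ∑ n (λ k → f (suc k) Q.+ g (suc k)) ≡⟨ cong ((f 0 Q.+ g 0) Q.+_) (∑-+ n _ _) ⟩
  (f 0 Q.+ g 0) Q.+ (∑ n (f ∘ suc) Q.+ ∑ n (g ∘ suc))
    ≡⟨ solve 4 (λ a b c d → (a :+ b) :+ (c :+ d) := (a :+ c) :+ (b :+ d)) refl (f 0) (g 0) _ _ ⟩
  (f 0 Q.+ ∑ n (f ∘ suc)) Q.+ (g 0 Q.+ ∑ n (g ∘ suc)) ∎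

∑-*ˡ : ∀ n c f → ∑ n (λ k → c Q.* f k) ≡ c Q.* ∑ n f
∑-*ˡ zero    c f = sym (QP.*-zeroʳ c)
∑-*ˡ (suc n) c f = trans (cong (c Q.* f 0 Q.+_) (∑-*ˡ n c (f ∘ suc))) (sym (QP.*-distribˡ-+ c _ _))

∑-*ʳ : ∀ n c f → ∑ n (λ k → f k Q.* c) ≡ ∑ n f Q.* c
∑-*ʳ n c f = trans (∑-ext n (λ k → QP.*-comm (f k) c)) (trans (∑-*ˡ n c f) (QP.*-comm c _))

∑-neg : ∀ n f → ∑ n (λ k → Q.- f k) ≡ Q.- ∑ n f
∑-neg zero    f = refl
∑-neg (suc n) f = trans (cong (Q.- f 0 Q.+_) (∑-neg n (f ∘ suc))) (sym (QP.neg-distrib-+ (f 0) _))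

∑-zero : ∀ n → ∑ n (λ _ → 0ℚ) ≡ 0ℚ
∑-zero zero    = refl
∑-zero (suc n) = trans (QP.+-identityˡ _) (∑-zero n)

∑-vanish : ∀ n f → (∀ k → k < n → f k ≡ 0ℚ) → ∑ n f ≡ 0ℚ
∑-vanish n f h = trans (∑-cong n h) (∑-zero n)

∑-const : ∀ n c → ∑ n (λ _ → c) ≡ ℕ→ℚ n Q.* c
∑-const zero    c = sym (QP.*-zeroˡ c)
∑-const (suc n) c = begin
  c Q.+ ∑ n (λ _ → c)       ≡⟨ cong (c Q.+_) (∑-const n c) ⟩
  c Q.+ ℕ→ℚ n Q.* c         ≡⟨ solve 2 (λ c x → c :+ x :* c := (con 1ℚ :+ x) :* c) refl c (ℕ→ℚ n) ⟩
  (1ℚ Q.+ ℕ→ℚ n) Q.* c      ≡⟨ cong (Q._* c) (sym (ℕ→ℚ-+ 1 n)) ⟩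
  ℕ→ℚ (suc n) Q.* c         ∎

∑-swap : ∀ n m (f : ℕ → ℕ → ℚ) → ∑ n (λ i → ∑ m (f i)) ≡ ∑ m (λ j → ∑ n (λ i → f i j))
∑-swap zero    m f = sym (∑-zero m)
∑-swap (suc n) m f = begin
  ∑ m (f 0) Q.+ ∑ n (λ i → ∑ m (f (suc i)))        ≡⟨ cong (∑ m (f 0) Q.+_) (∑-swap n m (f ∘ suc)) ⟩
  ∑ m (f 0) Q.+ ∑ m (λ j → ∑ n (λ i → f (suc i) j)) ≡⟨ sym (∑-+ m _ _) ⟩
  ∑ m (λ j → f 0 j Q.+ ∑ n (λ i → f (suc i) j))     ∎

∑-last : ∀ n f → ∑ (suc n) f ≡ ∑ n f Q.+ f n
∑-last zero    f = trans (QP.+-identityʳ (f 0)) (sym (QP.+-identityˡ (f 0)))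
∑-last (suc n) f = trans (cong (f 0 Q.+_) (∑-last n (f ∘ suc))) (sym (QP.+-assoc (f 0) _ _))

∑-split : ∀ a c f → ∑ (a + c) f ≡ ∑ a f Q.+ ∑ c (λ k → f (a + k))
∑-split zero    c f = sym (QP.+-identityˡ _)
∑-split (suc a) c f = trans (cong (f 0 Q.+_) (∑-split a c (f ∘ suc))) (sym (QP.+-assoc (f 0) _ _))

∑-pad : ∀ a c f → (∀ k → a ≤ k → f k ≡ 0ℚ) → ∑ (a + c) f ≡ ∑ a f
∑-pad a c f h = trans (∑-split a c f)
  (trans (cong (∑ a f Q.+_) (∑-vanish c _ (λ k _ → h (a + k) (NP.m≤m+n a k)))) (QP.+-identityʳ _))

∑-shift : ∀ c F → ∑ c (F ∘ suc) ≡ ∑ c F Q.+ F c Q.- F 0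
∑-shift c F = begin
  X                        ≡⟨ solve 2 (λ x f → x := (f :+ x) :- f) refl X (F 0) ⟩
  (F 0 Q.+ X) Q.- F 0      ≡⟨ cong (Q._- F 0) (∑-last c F) ⟩
  ∑ c F Q.+ F c Q.- F 0    ∎
  where X = ∑ c (F ∘ suc)

∑-single : ∀ n i (f : ℕ → ℚ) → i < n → (∀ j → j ≢ i → f j ≡ 0ℚ) → ∑ n f ≡ f i
∑-single (suc n) zero    f _ fz =
  trans (cong (f 0 Q.+_) (∑-vanish n (f ∘ suc) (λ j _ → fz (suc j) (λ ())))) (QP.+-identityʳ (f 0))
∑-single (suc n) (suc i) f (s≤s i<n) fz =
  trans (cong (Q._+ ∑ n (f ∘ suc)) (fz 0 (λ ())))
  (trans (QP.+-identityˡ _)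
         (∑-single n i (f ∘ suc) i<n (λ j j≢i → fz (suc j) (λ e → j≢i (NP.suc-injective e)))))

∑-affine : ∀ n (f : ℕ → ℚ) a c →
  ∑ n (λ k → f k Q.* (a Q.* ℕ→ℚ k Q.+ c)) ≡ a Q.* ∑ n (λ k → f k Q.* ℕ→ℚ k) Q.+ c Q.* ∑ n f
∑-affine n f a c = begin
  ∑ n (λ k → f k Q.* (a Q.* ℕ→ℚ k Q.+ c))
    ≡⟨ ∑-ext n (λ k → solve 4 (λ f a c K → f :* (a :* K :+ c) := a :* (f :* K) :+ c :* f) refl (f k) a c (ℕ→ℚ k)) ⟩
  ∑ n (λ k → a Q.* (f k Q.* ℕ→ℚ k) Q.+ c Q.* f k)          ≡⟨ ∑-+ n _ _ ⟩
  ∑ n (λ k → a Q.* (f k Q.* ℕ→ℚ k)) Q.+ ∑ n (λ k → c Q.* f k)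
    ≡⟨ cong₂ Q._+_ (∑-*ˡ n a (λ k → f k Q.* ℕ→ℚ k)) (∑-*ˡ n c f) ⟩
  a Q.* ∑ n (λ k → f k Q.* ℕ→ℚ k) Q.+ c Q.* ∑ n f          ∎

∑-square : ∀ n (f : ℕ → ℚ) a c v →
  ∑ n (λ k → f k Q.* ((a Q.* ℕ→ℚ k Q.+ c) Q.* (a Q.* ℕ→ℚ k Q.+ c) Q.+ v))
  ≡ a Q.* a Q.* ∑ n (λ k → f k Q.* ℕ→ℚ k Q.* ℕ→ℚ k)
    Q.+ ℕ→ℚ 2 Q.* a Q.* c Q.* ∑ n (λ k → f k Q.* ℕ→ℚ k) Q.+ (c Q.* c Q.+ v) Q.* ∑ n f
∑-square n f a c v = begin
  ∑ n (λ k → f k Q.* ((a Q.* ℕ→ℚ k Q.+ c) Q.* (a Q.* ℕ→ℚ k Q.+ c) Q.+ v))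
    ≡⟨ ∑-ext n (λ k → solve 5 (λ f a c v K → f :* ((a :* K :+ c) :* (a :* K :+ c) :+ v)
          := ((a :* a) :* (f :* K :* K) :+ (con (ℕ→ℚ 2) :* a :* c) :* (f :* K)) :+ (c :* c :+ v) :* f)
          refl (f k) a c v (ℕ→ℚ k)) ⟩
  ∑ n (λ k → (A2 Q.* (f k Q.* ℕ→ℚ k Q.* ℕ→ℚ k) Q.+ A1 Q.* (f k Q.* ℕ→ℚ k)) Q.+ A0 Q.* f k)
    ≡⟨ trans (∑-+ n _ _) (cong₂ Q._+_ (∑-+ n _ _) (∑-*ˡ n A0 f)) ⟩
  ∑ n (λ k → A2 Q.* (f k Q.* ℕ→ℚ k Q.* ℕ→ℚ k)) Q.+ ∑ n (λ k → A1 Q.* (f k Q.* ℕ→ℚ k)) Q.+ A0 Q.* ∑ n f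
    ≡⟨ cong₂ (λ u w → u Q.+ w Q.+ A0 Q.* ∑ n f) (∑-*ˡ n A2 _) (∑-*ˡ n A1 _) ⟩
  A2 Q.* ∑ n (λ k → f k Q.* ℕ→ℚ k Q.* ℕ→ℚ k) Q.+ A1 Q.* ∑ n (λ k → f k Q.* ℕ→ℚ k) Q.+ A0 Q.* ∑ n f ∎
  where
    A2 = a Q.* a
    A1 = ℕ→ℚ 2 Q.* a Q.* c
    A0 = c Q.* c Q.+ v

½ : ℚ
½ = + 1 / 2

⅙ : ℚ
⅙ = + 1 / 6

1/12 : ℚ
1/12 = + 1 / 12

-- Σ_{d<c} d = c(c-1)/2  and  Σ_{d<c} d² = c(c-1)(2c-1)/6.
triangular : ℚ → ℚ
triangular X = X Q.* (X Q.- 1ℚ) Q.* ½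

pyramidal : ℚ → ℚ
pyramidal X = X Q.* (X Q.- 1ℚ) Q.* (X Q.+ X Q.- 1ℚ) Q.* ⅙

∑-quadratic : ∀ c a₂ a₁ a₀ → ∑ c (λ d → a₂ Q.* ℕ→ℚ d Q.* ℕ→ℚ d Q.+ a₁ Q.* ℕ→ℚ d Q.+ a₀)
              ≡ a₂ Q.* pyramidal (ℕ→ℚ c) Q.+ a₁ Q.* triangular (ℕ→ℚ c) Q.+ a₀ Q.* ℕ→ℚ c
∑-quadratic zero a₂ a₁ a₀ =
  solve 3 (λ a₂ a₁ a₀ → con 0ℚ := a₂ :* con (pyramidal 0ℚ) :+ a₁ :* con (triangular 0ℚ) :+ a₀ :* con 0ℚ) refl a₂ a₁ a₀
∑-quadratic (suc c) a₂ a₁ a₀ = begin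
  ∑ (suc c) f                     ≡⟨ ∑-last c f ⟩
  ∑ c f Q.+ f c                   ≡⟨ cong (Q._+ f c) (∑-quadratic c a₂ a₁ a₀) ⟩
  a₂ Q.* pyramidal X Q.+ a₁ Q.* triangular X Q.+ a₀ Q.* X Q.+ (a₂ Q.* X Q.* X Q.+ a₁ Q.* X Q.+ a₀)
    ≡⟨ solve 4 (λ a₂ a₁ a₀ X →
          a₂ :* (X :* (X :- con 1ℚ) :* (X :+ X :- con 1ℚ) :* con ⅙) :+ a₁ :* (X :* (X :- con 1ℚ) :* con ½) :+ a₀ :* X
            :+ (a₂ :* X :* X :+ a₁ :* X :+ a₀)
       := a₂ :* ((con 1ℚ :+ X) :* ((con 1ℚ :+ X) :- con 1ℚ) :* ((con 1ℚ :+ X) :+ (con 1ℚ :+ X) :- con 1ℚ) :* con ⅙)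
          :+ a₁ :* ((con 1ℚ :+ X) :* ((con 1ℚ :+ X) :- con 1ℚ) :* con ½) :+ a₀ :* (con 1ℚ :+ X)) refl a₂ a₁ a₀ X ⟩
  a₂ Q.* pyramidal (1ℚ Q.+ X) Q.+ a₁ Q.* triangular (1ℚ Q.+ X) Q.+ a₀ Q.* (1ℚ Q.+ X)
    ≡⟨ cong (λ Y → a₂ Q.* pyramidal Y Q.+ a₁ Q.* triangular Y Q.+ a₀ Q.* Y) (sym (ℕ→ℚ-+ 1 c)) ⟩
  a₂ Q.* pyramidal (ℕ→ℚ (suc c)) Q.+ a₁ Q.* triangular (ℕ→ℚ (suc c)) Q.+ a₀ Q.* ℕ→ℚ (suc c) ∎
  where
    f = λ d → a₂ Q.* ℕ→ℚ d Q.* ℕ→ℚ d Q.+ a₁ Q.* ℕ→ℚ d Q.+ a₀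
    X = ℕ→ℚ c

sign : ℕ → ℚ
sign l = ℤ→ℚ (sgn l)

sign-suc : ∀ l → sign (suc l) ≡ Q.- sign l
sign-suc l = ℤ→ℚ-neg (sgn l)

-- tuplesBelow k Y is the number of k-tuples of naturals with sum < Y,
-- namely C(Y-1+k, k) for Y ≥ 1 and 0 for Y = 0.
tuplesBelow : ℕ → ℕ → ℕ
tuplesBelow k zero    = 0
tuplesBelow k (suc Y) = (Y + k) C k

-- Splitting off the last coordinate (Pascal's rule).
tuplesBelow-suc : ∀ k Y → tuplesBelow (suc k) Y ≡ tuplesBelow k Y + tuplesBelow (suc k) (Y ∸ 1)
tuplesBelow-suc k zero          = refl
tuplesBelow-suc k (suc zero)    = trans (nCn≡1 (suc k)) (cong (_+ 0) (sym (nCn≡1 k)))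
tuplesBelow-suc k (suc (suc Y)) = begin
  (suc Y + suc k) C suc k                 ≡⟨ cong (λ x → suc x C suc k) (NP.+-suc Y k) ⟩
  suc (suc (Y + k)) C suc k               ≡⟨ sym (nCk+nC[k+1]≡[n+1]C[k+1] (suc (Y + k)) k) ⟩
  suc (Y + k) C k + suc (Y + k) C suc k   ≡⟨ cong (λ x → suc (Y + k) C k + x C suc k) (sym (NP.+-suc Y k)) ⟩
  (suc Y + k) C k + (Y + suc k) C suc k   ∎

tuplesBelowℚ : ℕ → ℕ → ℚ
tuplesBelowℚ k Y = ℕ→ℚ (tuplesBelow k Y)

-- Hockey stick: tuples whose first coordinate is below c.
hockey-stick : ∀ k c Y →
  ∑ c (λ d → tuplesBelowℚ k (Y ∸ d)) ≡ tuplesBelowℚ (suc k) Y Q.- tuplesBelowℚ (suc k) (Y ∸ c)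
hockey-stick k zero    Y = sym (QP.+-inverseʳ (tuplesBelowℚ (suc k) Y))
hockey-stick k (suc c) Y = begin
  ∑ (suc c) (λ d → tuplesBelowℚ k (Y ∸ d))                  ≡⟨ ∑-last c _ ⟩
  ∑ c (λ d → tuplesBelowℚ k (Y ∸ d)) Q.+ tuplesBelowℚ k (Y ∸ c) ≡⟨ cong (Q._+ tuplesBelowℚ k (Y ∸ c)) (hockey-stick k c Y) ⟩
  T₀ Q.- tuplesBelowℚ (suc k) (Y ∸ c) Q.+ Tc
    ≡⟨ cong (λ x → T₀ Q.- x Q.+ Tc) (trans (cong ℕ→ℚ (tuplesBelow-suc k (Y ∸ c))) (ℕ→ℚ-+ (tuplesBelow k (Y ∸ c)) _)) ⟩
  T₀ Q.- (Tc Q.+ tuplesBelowℚ (suc k) (Y ∸ c ∸ 1)) Q.+ Tc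
    ≡⟨ solve 3 (λ a x y → a :- (x :+ y) :+ x := a :- y) refl T₀ Tc (tuplesBelowℚ (suc k) (Y ∸ c ∸ 1)) ⟩
  T₀ Q.- tuplesBelowℚ (suc k) (Y ∸ c ∸ 1)
    ≡⟨ cong (λ x → T₀ Q.- tuplesBelowℚ (suc k) x) (trans (NP.∸-+-assoc Y c 1) (cong (Y ∸_) (NP.+-comm c 1))) ⟩
  T₀ Q.- tuplesBelowℚ (suc k) (Y ∸ suc c) ∎
  where
    T₀ = tuplesBelowℚ (suc k) Y
    Tc = tuplesBelowℚ k (Y ∸ c)

alternating-pascal : ∀ k (A : ℕ → ℚ) →
  ∑ (suc k) (λ l → sign l Q.* ℕ→ℚ (k C l) Q.* (A l Q.- A (suc l)))
  ≡ ∑ (suc (suc k)) (λ l → sign l Q.* ℕ→ℚ (suc k C l) Q.* A l)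
alternating-pascal k A = begin
  ∑ (suc k) (λ l → sign l Q.* ℕ→ℚ (k C l) Q.* (A l Q.- A (suc l)))
    ≡⟨ ∑-ext (suc k) split ⟩
  ∑ (suc k) (λ l → sign l Q.* ℕ→ℚ (k C l) Q.* A l Q.+ H l)   ≡⟨ ∑-+ (suc k) (λ l → sign l Q.* ℕ→ℚ (k C l) Q.* A l) H ⟩
  (X₀ Q.+ ∑ k G) Q.+ ∑ (suc k) H
    ≡⟨ solve 3 (λ x g h → (x :+ g) :+ h := x :+ (h :+ (g :+ con 0ℚ))) refl X₀ (∑ k G) (∑ (suc k) H) ⟩
  X₀ Q.+ (∑ (suc k) H Q.+ (∑ k G Q.+ 0ℚ))
    ≡⟨ cong (λ x → X₀ Q.+ (∑ (suc k) H Q.+ x)) (trans (cong (∑ k G Q.+_) (sym G-last)) (sym (∑-last k G))) ⟩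
  X₀ Q.+ (∑ (suc k) H Q.+ ∑ (suc k) G)                     ≡⟨ cong (X₀ Q.+_) (sym (∑-+ (suc k) H G)) ⟩
  X₀ Q.+ ∑ (suc k) (λ l → H l Q.+ G l)                      ≡⟨ cong (X₀ Q.+_) (∑-ext (suc k) pascal) ⟩
  X₀ Q.+ ∑ (suc k) (λ l → sign (suc l) Q.* ℕ→ℚ (suc k C suc l) Q.* A (suc l)) ∎
  where
    H = λ l → sign (suc l) Q.* ℕ→ℚ (k C l) Q.* A (suc l)
    G = λ l → sign (suc l) Q.* ℕ→ℚ (k C suc l) Q.* A (suc l)
    X₀ = sign 0 Q.* ℕ→ℚ (k C 0) Q.* A 0
    split : ∀ l → sign l Q.* ℕ→ℚ (k C l) Q.* (A l Q.- A (suc l)) ≡ sign l Q.* ℕ→ℚ (k C l) Q.* A l Q.+ H l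
    split l = trans
      (solve 4 (λ s c a a' → s :* c :* (a :- a') := s :* c :* a :+ (:- s) :* c :* a') refl (sign l) (ℕ→ℚ (k C l)) (A l) (A (suc l)))
      (cong (λ x → sign l Q.* ℕ→ℚ (k C l) Q.* A l Q.+ x Q.* ℕ→ℚ (k C l) Q.* A (suc l)) (sym (sign-suc l)))
    G-last : G k ≡ 0ℚ
    G-last = trans (cong (λ x → sign (suc k) Q.* ℕ→ℚ x Q.* A (suc k)) (k>n⇒nCk≡0 (NP.n<1+n k)))
      (solve 2 (λ s a → s :* con 0ℚ :* a := con 0ℚ) refl (sign (suc k)) (A (suc k)))
    pascal : ∀ l → H l Q.+ G l ≡ sign (suc l) Q.* ℕ→ℚ (suc k C suc l) Q.* A (suc l)
    pascal l = trans
      (solve 4 (λ s x y a → s :* x :* a :+ s :* y :* a := s :* (x :+ y) :* a) refl (sign (suc l)) (ℕ→ℚ (k C l)) (ℕ→ℚ (k C suc l)) (A (suc l)))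
      (cong (λ x → sign (suc l) Q.* x Q.* A (suc l))
            (trans (sym (ℕ→ℚ-+ (k C l) (k C suc l))) (cong ℕ→ℚ (nCk+nC[k+1]≡[n+1]C[k+1] k l))))

below : ℕ → ℕ → ℚ
below zero    t       = 0ℚ
below (suc T) zero    = 1ℚ
below (suc T) (suc t) = below T t

below-yes : ∀ {T t} → t < T → below T t ≡ 1ℚ
below-yes {suc T} {zero}  _         = refl
below-yes {suc T} {suc t} (s≤s t<T) = below-yes t<T

below-no : ∀ {T t} → T ≤ t → below T t ≡ 0ℚ
below-no {zero}  {t}     _         = refl
below-no {suc T} {suc t} (s≤s T≤t) = below-no T≤t

below-tuplesBelow : ∀ T u → below T u ≡ tuplesBelowℚ 0 (T ∸ u)
below-tuplesBelow zero    zero    = refl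
below-tuplesBelow zero    (suc u) = refl
below-tuplesBelow (suc T) zero    = refl
below-tuplesBelow (suc T) (suc u) = below-tuplesBelow T u

module Digits (b : ℕ) .{{b≢0 : NonZero b}} where

  addDigit : (ℕ → ℚ) → ℕ → ℚ
  addDigit φ t = ∑ b (λ d → φ (t + d))

  -- overDigits k φ u = Σ_{d₁,…,d_k < b} φ (u + d₁ + … + d_k).
  overDigits : ℕ → (ℕ → ℚ) → ℕ → ℚ
  overDigits zero    φ u = φ u
  overDigits (suc k) φ u = overDigits k (addDigit φ) u

  overDigits-cong : ∀ k {φ ψ : ℕ → ℚ} → (∀ t → φ t ≡ ψ t) → ∀ u → overDigits k φ u ≡ overDigits k ψ u
  overDigits-cong zero    h u = h u
  overDigits-cong (suc k) h u = overDigits-cong k (λ t → ∑-ext b (λ d → h (t + d))) u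

  overDigits-local : ∀ k V {φ ψ : ℕ → ℚ} → (∀ t → t ≤ V + k * (b ∸ 1) → φ t ≡ ψ t) →
                     ∀ u → u ≤ V → overDigits k φ u ≡ overDigits k ψ u
  overDigits-local zero    V h u u≤V = h u (NP.≤-trans u≤V (NP.m≤m+n V 0))
  overDigits-local (suc k) V h u u≤V =
    overDigits-local k V (λ t t≤ → ∑-cong b (λ d d<b → h (t + d) (bound t d t≤ d<b))) u u≤V
    where
      bound : ∀ t d → t ≤ V + k * (b ∸ 1) → d < b → t + d ≤ V + suc k * (b ∸ 1)
      bound t d t≤ d<b = NP.≤-trans (NP.+-mono-≤ t≤ (NP.≤-pred (NP.≤-trans d<b (NP.≤-reflexive (sym (NP.suc-pred b))))))
        (NP.≤-reflexive (trans (NP.+-assoc V _ _) (cong (λ w → V + w) (NP.+-comm (k * (b ∸ 1)) (b ∸ 1)))))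

  overDigits-outer : ∀ k φ u → overDigits (suc k) φ u ≡ ∑ b (λ d → overDigits k φ (u + d))
  overDigits-outer zero    φ u = refl
  overDigits-outer (suc k) φ u = overDigits-outer k (addDigit φ) u

  overDigits-∑ : ∀ k n (φ : ℕ → ℕ → ℚ) u →
    ∑ n (λ j → overDigits k (φ j) u) ≡ overDigits k (λ t → ∑ n (λ j → φ j t)) u
  overDigits-∑ zero    n φ u = refl
  overDigits-∑ (suc k) n φ u = trans (overDigits-∑ k n (λ j → addDigit (φ j)) u)
    (overDigits-cong k (λ t → ∑-swap n b (λ j d → φ j (t + d))) u)

  overDigits-+ : ∀ k φ ψ u → overDigits k (λ t → φ t Q.+ ψ t) u ≡ overDigits k φ u Q.+ overDigits k ψ u
  overDigits-+ zero    φ ψ u = refl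
  overDigits-+ (suc k) φ ψ u = trans (overDigits-cong k (λ t → ∑-+ b (λ d → φ (t + d)) (λ d → ψ (t + d))) u)
    (overDigits-+ k (addDigit φ) (addDigit ψ) u)

  overDigits-*ˡ : ∀ k c φ u → overDigits k (λ t → c Q.* φ t) u ≡ c Q.* overDigits k φ u
  overDigits-*ˡ zero    c φ u = refl
  overDigits-*ˡ (suc k) c φ u = trans (overDigits-cong k (λ t → ∑-*ˡ b c (λ d → φ (t + d))) u)
    (overDigits-*ˡ k c (addDigit φ) u)

  overDigits-*ʳ : ∀ k c φ u → overDigits k φ u Q.* c ≡ overDigits k (λ t → φ t Q.* c) u
  overDigits-*ʳ k c φ u = trans (QP.*-comm _ c)
    (trans (sym (overDigits-*ˡ k c φ u)) (overDigits-cong k (λ t → QP.*-comm c (φ t)) u))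

  overDigits-neg : ∀ k φ u → overDigits k (λ t → Q.- φ t) u ≡ Q.- overDigits k φ u
  overDigits-neg zero    φ u = refl
  overDigits-neg (suc k) φ u = trans (overDigits-cong k (λ t → ∑-neg b (λ d → φ (t + d))) u)
    (overDigits-neg k (addDigit φ) u)

  -- Inclusion–exclusion: the number of digit tuples with u + Σd < T is
  -- Σ_l (-1)^l C(k,l) · tuplesBelow k (T - u - l·b).
  countTerm : ℕ → ℕ → ℕ → ℕ → ℚ
  countTerm k T u l = sign l Q.* ℕ→ℚ (k C l) Q.* tuplesBelowℚ k (T ∸ (u + l * b))

  count-below : ∀ k T u → overDigits k (below T) u ≡ ∑ (suc k) (countTerm k T u)
  count-below zero T u = begin
    below T u                       ≡⟨ below-tuplesBelow T u ⟩
    tuplesBelowℚ 0 (T ∸ u)          ≡⟨ cong (λ x → tuplesBelowℚ 0 (T ∸ x)) (sym (NP.+-identityʳ u)) ⟩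
    tuplesBelowℚ 0 (T ∸ (u + 0))    ≡⟨ solve 1 (λ x → x := con 1ℚ :* con 1ℚ :* x :+ con 0ℚ) refl _ ⟩
    ∑ 1 (countTerm 0 T u)           ∎
  count-below (suc k) T u = begin
    overDigits (suc k) (below T) u                          ≡⟨ overDigits-outer k (below T) u ⟩
    ∑ b (λ d → overDigits k (below T) (u + d))              ≡⟨ ∑-ext b (λ d → count-below k T (u + d)) ⟩
    ∑ b (λ d → ∑ (suc k) (countTerm k T (u + d)))           ≡⟨ ∑-swap b (suc k) (λ d → countTerm k T (u + d)) ⟩
    ∑ (suc k) (λ l → ∑ b (λ d → countTerm k T (u + d) l))   ≡⟨ ∑-ext (suc k) first-digit ⟩
    ∑ (suc k) (λ l → sign l Q.* ℕ→ℚ (k C l) Q.* (A l Q.- A (suc l))) ≡⟨ alternating-pascal k A ⟩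
    ∑ (suc (suc k)) (countTerm (suc k) T u)                 ∎
    where
      A = λ l → tuplesBelowℚ (suc k) (T ∸ (u + l * b))
      reassoc : ∀ l d → T ∸ (u + d + l * b) ≡ T ∸ (u + l * b) ∸ d
      reassoc l d = trans (cong (T ∸_) (trans (NP.+-assoc u d (l * b))
                            (trans (cong (λ w → u + w) (NP.+-comm d (l * b))) (sym (NP.+-assoc u (l * b) d)))))
                          (sym (NP.∸-+-assoc T (u + l * b) d))
      next : ∀ l → T ∸ (u + l * b) ∸ b ≡ T ∸ (u + suc l * b)
      next l = trans (NP.∸-+-assoc T (u + l * b) b)
        (cong (T ∸_) (trans (NP.+-assoc u (l * b) b) (cong (λ w → u + w) (NP.+-comm (l * b) b))))
      -- summing over the first digit is a hockey-stick sum
      first-digit : ∀ l → ∑ b (λ d → countTerm k T (u + d) l) ≡ sign l Q.* ℕ→ℚ (k C l) Q.* (A l Q.- A (suc l))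
      first-digit l = begin
        ∑ b (λ d → countTerm k T (u + d) l)
          ≡⟨ ∑-ext b (λ d → cong (λ x → sign l Q.* ℕ→ℚ (k C l) Q.* tuplesBelowℚ k x) (reassoc l d)) ⟩
        ∑ b (λ d → sign l Q.* ℕ→ℚ (k C l) Q.* tuplesBelowℚ k (T ∸ (u + l * b) ∸ d))
          ≡⟨ ∑-*ˡ b (sign l Q.* ℕ→ℚ (k C l)) _ ⟩
        sign l Q.* ℕ→ℚ (k C l) Q.* ∑ b (λ d → tuplesBelowℚ k (T ∸ (u + l * b) ∸ d))
          ≡⟨ cong (sign l Q.* ℕ→ℚ (k C l) Q.*_) (hockey-stick k b (T ∸ (u + l * b))) ⟩
        sign l Q.* ℕ→ℚ (k C l) Q.* (A l Q.- tuplesBelowℚ (suc k) (T ∸ (u + l * b) ∸ b))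
          ≡⟨ cong (λ x → sign l Q.* ℕ→ℚ (k C l) Q.* (A l Q.- tuplesBelowℚ (suc k) x)) (next l) ⟩
        sign l Q.* ℕ→ℚ (k C l) Q.* (A l Q.- A (suc l)) ∎

  0<b : 0 < b
  0<b = N.>-nonZero⁻¹ b

  divmod-unique : ∀ q r → r < b → (r + q * b) N./ b ≡ q × (r + q * b) N.% b ≡ r
  divmod-unique q r r<b =
      trans (DM.+-distrib-/ r (q * b) small) (cong₂ _+_ (DM.m<n⇒m/n≡0 r<b) (DM.m*n/n≡m q b))
    , trans (DM.[m+kn]%n≡m%n r q b) (DM.m<n⇒m%n≡m r<b)
    where
      small : r N.% b + (q * b) N.% b < b
      small = subst (_< b) (sym (cong₂ _+_ (DM.m<n⇒m%n≡m r<b) (DM.m*n%n≡0 q b)))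
                    (subst (_< b) (sym (NP.+-identityʳ r)) r<b)

  below-next-multiple : ∀ t → t < suc (t N./ b) * b
  below-next-multiple t = subst (_< suc (t N./ b) * b) (sym (DM.m≡m%n+[m/n]*n t b))
    (NP.+-monoˡ-< ((t N./ b) * b) (DM.m%n<n t b))

  data SucCase (t : ℕ) : Set where
    nowrap : suc (t N.% b) < b → suc t N./ b ≡ t N./ b → suc t N.% b ≡ suc (t N.% b) → SucCase t
    wrap   : suc (t N.% b) ≡ b → suc t N./ b ≡ suc (t N./ b) → suc t N.% b ≡ 0 → SucCase t

  suc-divmod : ∀ t → SucCase t
  suc-divmod t with NP.m≤n⇒m<n∨m≡n (DM.m%n<n t b)
  ... | inj₁ r<b = nowrap r<b (proj₁ u) (proj₂ u)
    where
      u = subst (λ x → x N./ b ≡ t N./ b × x N.% b ≡ suc (t N.% b)) (sym (cong suc (DM.m≡m%n+[m/n]*n t b)))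
                (divmod-unique (t N./ b) (suc (t N.% b)) r<b)
  ... | inj₂ r≡b = wrap r≡b (proj₁ u) (proj₂ u)
    where
      e : suc t ≡ 0 + suc (t N./ b) * b
      e = trans (cong suc (DM.m≡m%n+[m/n]*n t b)) (cong (_+ (t N./ b) * b) r≡b)
      u = subst (λ x → x N./ b ≡ suc (t N./ b) × x N.% b ≡ 0) (sym e) (divmod-unique (suc (t N./ b)) 0 0<b)

  +b-quotient : ∀ t → (t + b) N./ b ≡ suc (t N./ b)
  +b-quotient t = trans (cong (N._/ b) e) (proj₁ (divmod-unique (suc (t N./ b)) (t N.% b) (DM.m%n<n t b)))
    where
      e : t + b ≡ t N.% b + suc (t N./ b) * b
      e = trans (cong (_+ b) (DM.m≡m%n+[m/n]*n t b))
        (trans (NP.+-assoc (t N.% b) _ b) (cong (λ w → t N.% b + w) (NP.+-comm ((t N./ b) * b) b)))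

  -- The carry out of a column.  A column receiving carry i whose digits sum
  -- to D passes on the carry ⌊(i + D)/b⌋; carryIs j t indicates ⌊t/b⌋ = j.
  carryIs : ℕ → ℕ → ℚ
  carryIs j t = below (suc j * b) t Q.- below (j * b) t

  below-multiple : ∀ j t → below (j * b) t ≡ below j (t N./ b)
  below-multiple j t with t N./ b N.<? j
  ... | yes q<j = trans (below-yes (NP.<-≤-trans (below-next-multiple t) (NP.*-monoˡ-≤ b q<j)))
                        (sym (below-yes q<j))
  ... | no  q≮j = trans (below-no (NP.≮⇒≥ (λ t<jb → q≮j (DM.m<n*o⇒m/o<n {t} {j} {b} t<jb))))
                        (sym (below-no (NP.≮⇒≥ q≮j)))

  select : ∀ n q (w : ℕ → ℚ) → q < n → ∑ n (λ j → (below (suc j) q Q.- below j q) Q.* w j) ≡ w q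
  select (suc n) zero w _ = begin
    (1ℚ Q.- 0ℚ) Q.* w 0 Q.+ ∑ n (λ j → (1ℚ Q.- 1ℚ) Q.* w (suc j))
      ≡⟨ cong ((1ℚ Q.- 0ℚ) Q.* w 0 Q.+_) (∑-vanish n _ (λ j _ → solve 1 (λ x → (con 1ℚ :- con 1ℚ) :* x := con 0ℚ) refl (w (suc j)))) ⟩
    (1ℚ Q.- 0ℚ) Q.* w 0 Q.+ 0ℚ ≡⟨ solve 1 (λ x → (con 1ℚ :- con 0ℚ) :* x :+ con 0ℚ := x) refl (w 0) ⟩
    w 0 ∎
  select (suc n) (suc q) w (s≤s q<n) = begin
    (0ℚ Q.- 0ℚ) Q.* w 0 Q.+ ∑ n (λ j → (below (suc j) q Q.- below j q) Q.* w (suc j))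
      ≡⟨ cong ((0ℚ Q.- 0ℚ) Q.* w 0 Q.+_) (select n q (w ∘ suc) q<n) ⟩
    (0ℚ Q.- 0ℚ) Q.* w 0 Q.+ w (suc q) ≡⟨ solve 2 (λ x y → (con 0ℚ :- con 0ℚ) :* x :+ y := y) refl (w 0) (w (suc q)) ⟩
    w (suc q) ∎

  carry-select : ∀ n t (w : ℕ → ℚ) → t N./ b < n → ∑ n (λ j → carryIs j t Q.* w j) ≡ w (t N./ b)
  carry-select n t w q<n =
    trans (∑-ext n (λ j → cong₂ (λ x y → (x Q.- y) Q.* w j) (below-multiple (suc j) t) (below-multiple j t)))
          (select n (t N./ b) w q<n)

  -- Inclusion–exclusion count of the digit tuples producing carry j from carry i:
  -- it has the terms (-1)^l C(n+1,l) · tuplesBelow n ((j+1)b - i - l·b).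
  carryTerm : ℕ → ℕ → ℕ → ℕ → ℚ
  carryTerm n i j l = sign l Q.* ℕ→ℚ (suc n C l) Q.* tuplesBelowℚ n ((suc j * b) ∸ (i + l * b))

  -- The carry indicator is a difference of two `below` indicators, whose
  -- inclusion–exclusion sums combine by alternating-pascal.
  count-carry : ∀ n i j → overDigits n (carryIs j) i ≡ ∑ (suc (suc n)) (carryTerm n i j)
  count-carry n i j = begin
    overDigits n (λ t → below T₁ t Q.+ Q.- below T₀ t) i
      ≡⟨ overDigits-+ n (below T₁) (λ t → Q.- below T₀ t) i ⟩
    overDigits n (below T₁) i Q.+ overDigits n (λ t → Q.- below T₀ t) i
      ≡⟨ cong (overDigits n (below T₁) i Q.+_) (overDigits-neg n (below T₀) i) ⟩
    overDigits n (below T₁) i Q.- overDigits n (below T₀) i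
      ≡⟨ cong₂ Q._-_ (count-below n T₁ i) (count-below n T₀ i) ⟩
    ∑ (suc n) (countTerm n T₁ i) Q.- ∑ (suc n) (countTerm n T₀ i)
      ≡⟨ cong (∑ (suc n) (countTerm n T₁ i) Q.+_) (sym (∑-neg (suc n) (countTerm n T₀ i))) ⟩
    ∑ (suc n) (countTerm n T₁ i) Q.+ ∑ (suc n) (λ l → Q.- countTerm n T₀ i l)
      ≡⟨ sym (∑-+ (suc n) (countTerm n T₁ i) (λ l → Q.- countTerm n T₀ i l)) ⟩
    ∑ (suc n) (λ l → countTerm n T₁ i l Q.+ Q.- countTerm n T₀ i l) ≡⟨ ∑-ext (suc n) difference ⟩
    ∑ (suc n) (λ l → sign l Q.* ℕ→ℚ (n C l) Q.* (A l Q.- A (suc l))) ≡⟨ alternating-pascal n A ⟩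
    ∑ (suc (suc n)) (carryTerm n i j) ∎
    where
      T₁ = suc j * b
      T₀ = j * b
      A = λ l → tuplesBelowℚ n (T₁ ∸ (i + l * b))
      shift : ∀ l → T₁ ∸ (i + suc l * b) ≡ T₀ ∸ (i + l * b)
      shift l = trans (cong (T₁ ∸_) (trans (sym (NP.+-assoc i b (l * b)))
                        (trans (cong (_+ l * b) (NP.+-comm i b)) (NP.+-assoc b i (l * b)))))
                      (NP.[m+n]∸[m+o]≡n∸o b (j * b) (i + l * b))
      difference : ∀ l → countTerm n T₁ i l Q.+ Q.- countTerm n T₀ i l ≡ sign l Q.* ℕ→ℚ (n C l) Q.* (A l Q.- A (suc l))
      difference l = trans (cong (λ x → countTerm n T₁ i l Q.+ Q.- (sign l Q.* ℕ→ℚ (n C l) Q.* tuplesBelowℚ n x)) (sym (shift l)))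
        (solve 4 (λ s c a a' → s :* c :* a :+ :- (s :* c :* a') := s :* c :* (a :- a')) refl (sign l) (ℕ→ℚ (n C l)) (A l) (A (suc l)))

  carryTerm-binomial : ∀ n i j l → i < n → i N./ b ≤ j → l ≤ j ∸ i N./ b →
    tuplesBelow n ((suc j * b) ∸ (i + l * b)) ≡ ((n ∸ 1 ∸ i) + (suc j ∸ l) * b) C n
  carryTerm-binomial n i j l i<n q≤j l≤j-q = trans (cong (tuplesBelow n) positive) (cong (_C n) binomial)
    where
      q = i N./ b
      l+q≤j : l + q ≤ j
      l+q≤j = NP.≤-trans (NP.+-monoˡ-≤ q l≤j-q) (NP.≤-reflexive (NP.m∸n+n≡m q≤j))
      l≤j : l ≤ j
      l≤j = NP.≤-trans (NP.m≤m+n l q) l+q≤j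
      e = j ∸ l
      W = suc e * b
      i<W : i < W
      i<W = NP.<-≤-trans (below-next-multiple i)
        (NP.*-monoˡ-≤ b (s≤s (subst (_≤ e) (NP.m+n∸m≡n l q) (NP.∸-monoˡ-≤ l l+q≤j))))
      positive : (suc j * b) ∸ (i + l * b) ≡ suc (W ∸ suc i)
      positive = begin
        (suc j * b) ∸ (i + l * b)         ≡⟨ cong (λ x → (suc x * b) ∸ (i + l * b)) (sym (NP.m∸n+n≡m l≤j)) ⟩
        ((suc e + l) * b) ∸ (i + l * b)   ≡⟨ cong (_∸ (i + l * b)) (NP.*-distribʳ-+ b (suc e) l) ⟩
        (W + l * b) ∸ (i + l * b)         ≡⟨ cong₂ _∸_ (NP.+-comm W (l * b)) (NP.+-comm i (l * b)) ⟩
        (l * b + W) ∸ (l * b + i)         ≡⟨ NP.[m+n]∸[m+o]≡n∸o (l * b) W i ⟩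
        W ∸ i                             ≡⟨ NP.+-∸-assoc 1 {W} {suc i} i<W ⟩
        suc (W ∸ suc i)                   ∎
      binomial : (W ∸ suc i) + n ≡ (n ∸ 1 ∸ i) + (suc j ∸ l) * b
      binomial = begin
        (W ∸ suc i) + n                         ≡⟨ cong (λ w → (W ∸ suc i) + w) (sym (NP.m∸n+n≡m i<n)) ⟩
        (W ∸ suc i) + ((n ∸ suc i) + suc i)     ≡⟨ solve-+ (W ∸ suc i) (n ∸ suc i) (suc i) ⟩
        (n ∸ suc i) + ((W ∸ suc i) + suc i)     ≡⟨ cong (λ w → (n ∸ suc i) + w) (NP.m∸n+n≡m i<W) ⟩
        (n ∸ suc i) + W                         ≡⟨ cong₂ _+_ (sym (NP.∸-+-assoc n 1 i)) (cong (_* b) (sym (NP.+-∸-assoc 1 l≤j))) ⟩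
        (n ∸ 1 ∸ i) + (suc j ∸ l) * b           ∎
        where
          solve-+ : ∀ x y z → x + (y + z) ≡ y + (x + z)
          solve-+ x y z = trans (sym (NP.+-assoc x y z)) (trans (cong (_+ z) (NP.+-comm x y)) (NP.+-assoc y x z))

  carryTerm-late : ∀ i j l → i N./ b ≤ j → suc (j ∸ i N./ b) ≤ l → (suc j * b) ∸ (i + l * b) ≡ 0
  carryTerm-late i j l q≤j L≤l = NP.m≤n⇒m∸n≡0
    (NP.≤-trans (NP.≤-reflexive (cong (λ x → suc x * b) (sym (NP.m∸n+n≡m q≤j))))   -- (j+1)b = (j-q+q+1)b
    (NP.≤-trans (NP.*-monoˡ-≤ b (NP.+-monoˡ-≤ q L≤l))                           --       ≤ (l+q)b
    (NP.≤-trans (NP.≤-reflexive (NP.*-distribʳ-+ b l q))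
    (NP.≤-trans (NP.+-monoʳ-≤ (l * b) (DM.m/n*n≤m i b))                         --       ≤ lb + i
                (NP.≤-reflexive (NP.+-comm (l * b) i))))))
    where
      q = i N./ b

  carryTerm-early : ∀ i j l → j < i N./ b → (suc j * b) ∸ (i + l * b) ≡ 0
  carryTerm-early i j l j<q = NP.m≤n⇒m∸n≡0 (NP.≤-trans (NP.*-monoˡ-≤ b j<q)
     (NP.≤-trans (DM.m/n*n≤m i b) (NP.m≤m+n i (l * b))))

  carryTerm-vanishes : ∀ n i j l → (suc j * b) ∸ (i + l * b) ≡ 0 → carryTerm n i j l ≡ 0ℚ
  carryTerm-vanishes n i j l eq = trans (cong (λ x → sign l Q.* ℕ→ℚ (suc n C l) Q.* tuplesBelowℚ n x) eq)
    (solve 2 (λ s c → s :* c :* con 0ℚ := con 0ℚ) refl (sign l) (ℕ→ℚ (suc n C l)))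

  carryTerm-beyond : ∀ n i j l → suc (suc n) ≤ l → carryTerm n i j l ≡ 0ℚ
  carryTerm-beyond n i j l n+1<l = trans (cong (λ x → sign l Q.* ℕ→ℚ x Q.* A) (k>n⇒nCk≡0 n+1<l))
    (solve 2 (λ s a → s :* con 0ℚ :* a := con 0ℚ) refl (sign l) A)
    where A = tuplesBelowℚ n ((suc j * b) ∸ (i + l * b))

  MnumTerm : ℕ → ℕ → ℕ → ℕ → ℤ
  MnumTerm n i j l = sgn l Z.* (+ ((suc n) C l)) Z.* (+ (((n ∸ 1 ∸ i) + (suc j ∸ l) * b) C n))

  -- For ⌊i/b⌋ ≤ j, the numerator of M(i,j) is the inclusion–exclusion count,
  -- truncated where its terms start to vanish.
  Mnum-sum : ∀ n i j → i < n → i N./ b ≤ j →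
    ℤ→ℚ (Σℤ (upTo (suc (j ∸ i N./ b))) (MnumTerm n i j)) ≡ ∑ (suc (suc n)) (carryTerm n i j)
  Mnum-sum n i j i<n q≤j = begin
    ℤ→ℚ (Σℤ (upTo L) (MnumTerm n i j))      ≡⟨ ℤ→ℚ-Σℤ (upTo L) (MnumTerm n i j) ⟩
    Σℚ (upTo L) (ℤ→ℚ ∘ MnumTerm n i j)      ≡⟨ Σℚ-upTo L (ℤ→ℚ ∘ MnumTerm n i j) ⟩
    ∑ L (ℤ→ℚ ∘ MnumTerm n i j)              ≡⟨ ∑-cong L term ⟩
    ∑ L F                                   ≡⟨ sym (∑-pad L (suc (suc n)) F (λ l L≤l → carryTerm-vanishes n i j l (carryTerm-late i j l q≤j L≤l))) ⟩
    ∑ (L + suc (suc n)) F                   ≡⟨ cong (λ x → ∑ x F) (NP.+-comm L (suc (suc n))) ⟩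
    ∑ (suc (suc n) + L) F                   ≡⟨ ∑-pad (suc (suc n)) L F (carryTerm-beyond n i j) ⟩
    ∑ (suc (suc n)) F                       ∎
    where
      F = carryTerm n i j
      L = suc (j ∸ i N./ b)
      term : ∀ l → l < L → ℤ→ℚ (MnumTerm n i j l) ≡ F l
      term l l<L = begin
        ℤ→ℚ (MnumTerm n i j l)
          ≡⟨ trans (ℤ→ℚ-* (sgn l Z.* + (suc n C l)) (+ c)) (cong (Q._* ℕ→ℚ c) (ℤ→ℚ-* (sgn l) (+ (suc n C l)))) ⟩
        sign l Q.* ℕ→ℚ (suc n C l) Q.* ℕ→ℚ c
          ≡⟨ cong (λ x → sign l Q.* ℕ→ℚ (suc n C l) Q.* ℕ→ℚ x) (sym (carryTerm-binomial n i j l i<n q≤j (NP.≤-pred l<L))) ⟩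
        F l ∎
        where c = ((n ∸ 1 ∸ i) + (suc j ∸ l) * b) C n

  Mnum-counts : ∀ n i j → i < n → ℤ→ℚ (Mnum b n i j) ≡ overDigits n (carryIs j) i
  Mnum-counts n i j i<n with j N.<? i N./ b
  ... | yes j<q = sym (trans (count-carry n i j)
                      (∑-vanish (suc (suc n)) (carryTerm n i j) (λ l _ → carryTerm-vanishes n i j l (carryTerm-early i j l j<q))))
  ... | no  j≮q = trans (Mnum-sum n i j i<n (NP.≮⇒≥ j≮q)) (sym (count-carry n i j))

  y : ℚ
  y = + 1 / b

  M-moment : ∀ n i (w : ℕ → ℚ) → i < n →
             ∑ n (λ j → M b n i j Q.* w j) ≡ pow y n Q.* overDigits n (λ t → w (t N./ b)) i
  M-moment n i w i<n = begin
    ∑ n (λ j → M b n i j Q.* w j)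
      ≡⟨ ∑-ext n (λ j → trans (cong (Q._* w j) (trans (/-as-* (Mnum b n i j) (b N.^ n) {{NP.m^n≢0 b n}})
                                                  (cong₂ Q._*_ (Mnum-counts n i j i<n) (1/^ b n))))
                   (solve 3 (λ d z w → d :* z :* w := z :* (d :* w)) refl (overDigits n (carryIs j) i) (pow y n) (w j))) ⟩
    ∑ n (λ j → pow y n Q.* (overDigits n (carryIs j) i Q.* w j))      ≡⟨ ∑-*ˡ n (pow y n) _ ⟩
    pow y n Q.* ∑ n (λ j → overDigits n (carryIs j) i Q.* w j)
      ≡⟨ cong (pow y n Q.*_) (∑-ext n (λ j → overDigits-*ʳ n (w j) (carryIs j) i)) ⟩
    pow y n Q.* ∑ n (λ j → overDigits n (λ t → carryIs j t Q.* w j) i)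
      ≡⟨ cong (pow y n Q.*_) (overDigits-∑ n n (λ j t → carryIs j t Q.* w j) i) ⟩
    pow y n Q.* overDigits n (λ t → ∑ n (λ j → carryIs j t Q.* w j)) i
      ≡⟨ cong (pow y n Q.*_) (overDigits-local n i (λ t t≤ → carry-select n t w (DM.m<n*o⇒m/o<n {t} {n} {b} (NP.≤-<-trans t≤ bound))) i NP.≤-refl) ⟩
    pow y n Q.* overDigits n (λ t → w (t N./ b)) i ∎
    where
      -- the largest reachable value i + n(b-1) is below n·b, so the carry is below n
      bound : i + n * (b ∸ 1) < n * b
      bound = NP.<-≤-trans (NP.+-monoˡ-< (n * (b ∸ 1)) i<n)
        (NP.≤-reflexive (trans (sym (NP.*-suc n (b ∸ 1))) (cong (n *_) (NP.suc-pred b))))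

module DigitMoments (b : ℕ) .{{b≢0 : NonZero b}} where
  open Digits b

  B : ℚ
  B = ℕ→ℚ b

  -- Moving from t to t + 1 trades one copy of w ⌊t/b⌋ for one copy of
  -- w (⌊t/b⌋ + 1) in the expression of digit-quotients below.
  quotients-step : ∀ (w : ℕ → ℚ) t → SucCase t →
    let ρ = t N.% b ; q = t N./ b ; R = ℕ→ℚ ρ in
    (B Q.- R) Q.* w q Q.+ R Q.* w (suc q) Q.+ w (suc q) Q.- w q ≡
    ℕ→ℚ (b ∸ suc t N.% b) Q.* w (suc t N./ b) Q.+ ℕ→ℚ (suc t N.% b) Q.* w (suc (suc t N./ b))
  quotients-step w t (nowrap ρ+1<b q′≡q ρ′≡ρ+1) rewrite q′≡q | ρ′≡ρ+1 = begin
    (B Q.- R) Q.* w q Q.+ R Q.* w (suc q) Q.+ w (suc q) Q.- w q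
      ≡⟨ solve 4 (λ B R w₀ w₁ → (B :- R) :* w₀ :+ R :* w₁ :+ w₁ :- w₀ := (B :- (con 1ℚ :+ R)) :* w₀ :+ (con 1ℚ :+ R) :* w₁)
                 refl B R (w q) (w (suc q)) ⟩
    (B Q.- (1ℚ Q.+ R)) Q.* w q Q.+ (1ℚ Q.+ R) Q.* w (suc q)
      ≡⟨ sym (cong₂ (λ x z → x Q.* w q Q.+ z Q.* w (suc q))
                    (trans (ℕ→ℚ-∸ b (suc ρ) (NP.<⇒≤ ρ+1<b)) (cong (λ x → B Q.- x) (ℕ→ℚ-+ 1 ρ))) (ℕ→ℚ-+ 1 ρ)) ⟩
    ℕ→ℚ (b ∸ suc ρ) Q.* w q Q.+ ℕ→ℚ (suc ρ) Q.* w (suc q) ∎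
    where
      ρ = t N.% b
      q = t N./ b
      R = ℕ→ℚ ρ
  quotients-step w t (wrap ρ+1≡b q′≡q+1 ρ′≡0) rewrite q′≡q+1 | ρ′≡0 = begin
    (B Q.- R) Q.* w q Q.+ R Q.* w (suc q) Q.+ w (suc q) Q.- w q
      ≡⟨ cong (λ x → (x Q.- R) Q.* w q Q.+ R Q.* w (suc q) Q.+ w (suc q) Q.- w q)
              (trans (cong ℕ→ℚ (sym ρ+1≡b)) (ℕ→ℚ-+ 1 ρ)) ⟩
    ((1ℚ Q.+ R) Q.- R) Q.* w q Q.+ R Q.* w (suc q) Q.+ w (suc q) Q.- w q
      ≡⟨ solve 4 (λ R w₀ w₁ w₂ → ((con 1ℚ :+ R) :- R) :* w₀ :+ R :* w₁ :+ w₁ :- w₀ := (con 1ℚ :+ R) :* w₁ :+ con 0ℚ :* w₂)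
                 refl R (w q) (w (suc q)) (w (suc (suc q))) ⟩
    (1ℚ Q.+ R) Q.* w (suc q) Q.+ 0ℚ Q.* w (suc (suc q))
      ≡⟨ cong (λ x → x Q.* w (suc q) Q.+ 0ℚ Q.* w (suc (suc q))) (trans (sym (ℕ→ℚ-+ 1 ρ)) (cong ℕ→ℚ ρ+1≡b)) ⟩
    ℕ→ℚ (b ∸ 0) Q.* w (suc q) Q.+ ℕ→ℚ 0 Q.* w (suc (suc q)) ∎
    where
      ρ = t N.% b
      q = t N./ b
      R = ℕ→ℚ ρ

  digit-quotients : ∀ (w : ℕ → ℚ) t → addDigit (λ s → w (s N./ b)) t ≡
    ℕ→ℚ (b ∸ t N.% b) Q.* w (t N./ b) Q.+ ℕ→ℚ (t N.% b) Q.* w (suc (t N./ b))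
  digit-quotients w zero = begin
    ∑ b (λ d → w (d N./ b))        ≡⟨ ∑-cong b (λ d d<b → cong w (DM.m<n⇒m/n≡0 d<b)) ⟩
    ∑ b (λ _ → w 0)                ≡⟨ ∑-const b (w 0) ⟩
    B Q.* w 0                      ≡⟨ solve 3 (λ B w₀ w₁ → B :* w₀ := B :* w₀ :+ con 0ℚ :* w₁) refl B (w 0) (w 1) ⟩
    ℕ→ℚ (b ∸ 0) Q.* w 0 Q.+ ℕ→ℚ 0 Q.* w 1
      ≡⟨ sym (cong₂ (λ r q → ℕ→ℚ (b ∸ r) Q.* w q Q.+ ℕ→ℚ r Q.* w (suc q)) (DM.m<n⇒m%n≡m 0<b) (DM.m<n⇒m/n≡0 0<b)) ⟩
    ℕ→ℚ (b ∸ 0 N.% b) Q.* w (0 N./ b) Q.+ ℕ→ℚ (0 N.% b) Q.* w (suc (0 N./ b)) ∎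
  digit-quotients w (suc t) = begin
    ∑ b (λ d → w ((suc t + d) N./ b))   ≡⟨ ∑-ext b (λ d → cong (λ x → w (x N./ b)) (sym (NP.+-suc t d))) ⟩
    ∑ b (F ∘ suc)                       ≡⟨ ∑-shift b F ⟩
    ∑ b F Q.+ F b Q.- F 0               ≡⟨ cong₂ (λ x z → x Q.+ z Q.- F 0) (digit-quotients w t) (cong w (+b-quotient t)) ⟩
    ℕ→ℚ (b ∸ ρ) Q.* w q Q.+ R Q.* w (suc q) Q.+ w (suc q) Q.- w ((t + 0) N./ b)
      ≡⟨ cong₂ (λ x z → x Q.* w q Q.+ R Q.* w (suc q) Q.+ w (suc q) Q.- w (z N./ b))
               (ℕ→ℚ-∸ b ρ (NP.<⇒≤ (DM.m%n<n t b))) (NP.+-identityʳ t) ⟩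
    (B Q.- R) Q.* w q Q.+ R Q.* w (suc q) Q.+ w (suc q) Q.- w q ≡⟨ quotients-step w t (suc-divmod t) ⟩
    ℕ→ℚ (b ∸ suc t N.% b) Q.* w (suc t N./ b) Q.+ ℕ→ℚ (suc t N.% b) Q.* w (suc (suc t N./ b)) ∎
    where
      F = λ d → w ((t + d) N./ b)
      ρ = t N.% b
      q = t N./ b
      R = ℕ→ℚ ρ

  digit-remainders : ∀ (g : ℕ → ℚ) t → addDigit (λ s → g (s N.% b)) t ≡ ∑ b g
  digit-remainders g zero    = ∑-cong b (λ d d<b → cong g (DM.m<n⇒m%n≡m d<b))
  digit-remainders g (suc t) = begin
    ∑ b (λ d → g ((suc t + d) N.% b))  ≡⟨ ∑-ext b (λ d → cong (λ x → g (x N.% b)) (sym (NP.+-suc t d))) ⟩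
    ∑ b (G ∘ suc)                      ≡⟨ ∑-shift b G ⟩
    ∑ b G Q.+ G b Q.- G 0
      ≡⟨ cong (λ x → ∑ b G Q.+ g x Q.- G 0) (trans (DM.[m+n]%n≡m%n t b) (cong (N._% b) (sym (NP.+-identityʳ t)))) ⟩
    ∑ b G Q.+ G 0 Q.- G 0              ≡⟨ solve 2 (λ x z → x :+ z :- z := x) refl (∑ b G) (G 0) ⟩
    ∑ b G                              ≡⟨ digit-remainders g t ⟩
    ∑ b g                              ∎
    where G = λ d → g ((t + d) N.% b)

  -- Moments of a sum of k independent uniform digits, unnormalised: the sum
  -- over all digit tuples of a quadratic in u + Σd.  The mean of one digit is
  -- μ = (b-1)/2 and its variance is σ² = (b²-1)/12.
  μ : ℚ
  μ = (B Q.- 1ℚ) Q.* ½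

  σ² : ℚ
  σ² = (B Q.* B Q.- 1ℚ) Q.* 1/12

  quadratic : ℚ → ℚ → ℚ → ℕ → ℚ
  quadratic α β γ t = α Q.* ℕ→ℚ t Q.* ℕ→ℚ t Q.+ β Q.* ℕ→ℚ t Q.+ γ

  addDigit-quadratic : ∀ α β γ t → addDigit (quadratic α β γ) t ≡
    quadratic (α Q.* B) (ℕ→ℚ 2 Q.* α Q.* triangular B Q.+ β Q.* B)
              (α Q.* pyramidal B Q.+ β Q.* triangular B Q.+ γ Q.* B) t
  addDigit-quadratic α β γ t = begin
    ∑ b (λ d → quadratic α β γ (t + d))
      ≡⟨ ∑-ext b (λ d → trans (cong (λ s → α Q.* s Q.* s Q.+ β Q.* s Q.+ γ) (ℕ→ℚ-+ t d))
            (solve 5 (λ α β γ T D → α :* (T :+ D) :* (T :+ D) :+ β :* (T :+ D) :+ γ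
               := α :* D :* D :+ (con (ℕ→ℚ 2) :* α :* T :+ β) :* D :+ (α :* T :* T :+ β :* T :+ γ)) refl α β γ T (ℕ→ℚ d))) ⟩
    ∑ b (λ d → α Q.* ℕ→ℚ d Q.* ℕ→ℚ d Q.+ (ℕ→ℚ 2 Q.* α Q.* T Q.+ β) Q.* ℕ→ℚ d Q.+ quadratic α β γ t)
      ≡⟨ ∑-quadratic b α (ℕ→ℚ 2 Q.* α Q.* T Q.+ β) (quadratic α β γ t) ⟩
    α Q.* pyramidal B Q.+ (ℕ→ℚ 2 Q.* α Q.* T Q.+ β) Q.* triangular B Q.+ (α Q.* T Q.* T Q.+ β Q.* T Q.+ γ) Q.* B
      ≡⟨ solve 7 (λ α β γ T B s₁ s₂ → α :* s₂ :+ (con (ℕ→ℚ 2) :* α :* T :+ β) :* s₁ :+ (α :* T :* T :+ β :* T :+ γ) :* B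
           := (α :* B) :* T :* T :+ (con (ℕ→ℚ 2) :* α :* s₁ :+ β :* B) :* T :+ (α :* s₂ :+ β :* s₁ :+ γ :* B))
           refl α β γ T B (triangular B) (pyramidal B) ⟩
    quadratic (α Q.* B) (ℕ→ℚ 2 Q.* α Q.* triangular B Q.+ β Q.* B) (α Q.* pyramidal B Q.+ β Q.* triangular B Q.+ γ Q.* B) t ∎
    where T = ℕ→ℚ t

  overDigits-quadratic : ∀ k α β γ u → overDigits k (quadratic α β γ) u ≡
     pow B k Q.* (α Q.* ((ℕ→ℚ u Q.+ ℕ→ℚ k Q.* μ) Q.* (ℕ→ℚ u Q.+ ℕ→ℚ k Q.* μ) Q.+ ℕ→ℚ k Q.* σ²)
                  Q.+ β Q.* (ℕ→ℚ u Q.+ ℕ→ℚ k Q.* μ) Q.+ γ)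
  overDigits-quadratic zero α β γ u =
    solve 4 (λ α β γ U → α :* U :* U :+ β :* U :+ γ
       := con 1ℚ :* (α :* ((U :+ con 0ℚ :* con μ) :* (U :+ con 0ℚ :* con μ) :+ con 0ℚ :* con σ²) :+ β :* (U :+ con 0ℚ :* con μ) :+ γ))
       refl α β γ (ℕ→ℚ u)
  overDigits-quadratic (suc k) α β γ u = begin
    overDigits k (addDigit (quadratic α β γ)) u ≡⟨ overDigits-cong k (addDigit-quadratic α β γ) u ⟩
    overDigits k (quadratic α′ β′ γ′) u        ≡⟨ overDigits-quadratic k α′ β′ γ′ u ⟩
    pow B k Q.* (α′ Q.* ((U Q.+ K Q.* μ) Q.* (U Q.+ K Q.* μ) Q.+ K Q.* σ²) Q.+ β′ Q.* (U Q.+ K Q.* μ) Q.+ γ′)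
      ≡⟨ solve 7 (λ P α β γ U K B →
           P :* ((α :* B) :* ((U :+ K :* ((B :- con 1ℚ) :* con ½)) :* (U :+ K :* ((B :- con 1ℚ) :* con ½)) :+ K :* ((B :* B :- con 1ℚ) :* con 1/12))
                 :+ (con (ℕ→ℚ 2) :* α :* (B :* (B :- con 1ℚ) :* con ½) :+ β :* B) :* (U :+ K :* ((B :- con 1ℚ) :* con ½))
                 :+ (α :* (B :* (B :- con 1ℚ) :* (B :+ B :- con 1ℚ) :* con ⅙) :+ β :* (B :* (B :- con 1ℚ) :* con ½) :+ γ :* B))
         := (B :* P) :* (α :* ((U :+ (con 1ℚ :+ K) :* ((B :- con 1ℚ) :* con ½)) :* (U :+ (con 1ℚ :+ K) :* ((B :- con 1ℚ) :* con ½))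
                                :+ (con 1ℚ :+ K) :* ((B :* B :- con 1ℚ) :* con 1/12))
                         :+ β :* (U :+ (con 1ℚ :+ K) :* ((B :- con 1ℚ) :* con ½)) :+ γ)) refl (pow B k) α β γ U K B ⟩
    pow B (suc k) Q.* (α Q.* ((U Q.+ (1ℚ Q.+ K) Q.* μ) Q.* (U Q.+ (1ℚ Q.+ K) Q.* μ) Q.+ (1ℚ Q.+ K) Q.* σ²)
                       Q.+ β Q.* (U Q.+ (1ℚ Q.+ K) Q.* μ) Q.+ γ)
      ≡⟨ cong (λ K′ → pow B (suc k) Q.* (α Q.* ((U Q.+ K′ Q.* μ) Q.* (U Q.+ K′ Q.* μ) Q.+ K′ Q.* σ²) Q.+ β Q.* (U Q.+ K′ Q.* μ) Q.+ γ))
              (sym (ℕ→ℚ-+ 1 k)) ⟩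
    pow B (suc k) Q.* (α Q.* ((U Q.+ ℕ→ℚ (suc k) Q.* μ) Q.* (U Q.+ ℕ→ℚ (suc k) Q.* μ) Q.+ ℕ→ℚ (suc k) Q.* σ²)
                       Q.+ β Q.* (U Q.+ ℕ→ℚ (suc k) Q.* μ) Q.+ γ) ∎
    where
      U = ℕ→ℚ u
      K = ℕ→ℚ k
      α′ = α Q.* B
      β′ = ℕ→ℚ 2 Q.* α Q.* triangular B Q.+ β Q.* B
      γ′ = α Q.* pyramidal B Q.+ β Q.* triangular B Q.+ γ Q.* B

  overDigits-const : ∀ k c u → overDigits k (λ _ → c) u ≡ pow B k Q.* c
  overDigits-const k c u =
    trans (overDigits-cong k (λ t → solve 2 (λ c T → c := con 0ℚ :* T :* T :+ con 0ℚ :* T :+ c) refl c (ℕ→ℚ t)) u)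
    (trans (overDigits-quadratic k 0ℚ 0ℚ c u)
           (cong (pow B k Q.*_) (solve 3 (λ c x v → con 0ℚ :* (x :* x :+ v) :+ con 0ℚ :* x :+ c := c) refl c (ℕ→ℚ u Q.+ ℕ→ℚ k Q.* μ) (ℕ→ℚ k Q.* σ²))))

  overDigits-linear : ∀ k u → overDigits k ℕ→ℚ u ≡ pow B k Q.* (ℕ→ℚ u Q.+ ℕ→ℚ k Q.* μ)
  overDigits-linear k u =
    trans (overDigits-cong k (λ t → solve 1 (λ T → T := con 0ℚ :* T :* T :+ con 1ℚ :* T :+ con 0ℚ) refl (ℕ→ℚ t)) u)
    (trans (overDigits-quadratic k 0ℚ 1ℚ 0ℚ u)
           (cong (pow B k Q.*_) (solve 2 (λ z v → con 0ℚ :* (z :* z :+ v) :+ con 1ℚ :* z :+ con 0ℚ := z) refl (ℕ→ℚ u Q.+ ℕ→ℚ k Q.* μ) (ℕ→ℚ k Q.* σ²))))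

  overDigits-square : ∀ k u → overDigits k (λ t → ℕ→ℚ t Q.* ℕ→ℚ t) u ≡
    pow B k Q.* ((ℕ→ℚ u Q.+ ℕ→ℚ k Q.* μ) Q.* (ℕ→ℚ u Q.+ ℕ→ℚ k Q.* μ) Q.+ ℕ→ℚ k Q.* σ²)
  overDigits-square k u =
    trans (overDigits-cong k (λ t → solve 1 (λ T → T :* T := con 1ℚ :* T :* T :+ con 0ℚ :* T :+ con 0ℚ) refl (ℕ→ℚ t)) u)
    (trans (overDigits-quadratic k 1ℚ 0ℚ 0ℚ u)
           (cong (pow B k Q.*_) (solve 2 (λ z v → con 1ℚ :* (z :* z :+ v) :+ con 0ℚ :* z :+ con 0ℚ := z :* z :+ v)
                                            refl (ℕ→ℚ u Q.+ ℕ→ℚ k Q.* μ) (ℕ→ℚ k Q.* σ²))))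

  -- Rows of M.
  -- The computation uses Hermite's identity and the digit moments above.

  y·B≡1 : y Q.* B ≡ 1ℚ
  y·B≡1 = trans (QP.*-comm y B) (ℕ→ℚ-*-1/ b)

  pow-cancel : ∀ e k → pow y (e + k) Q.* pow B k ≡ pow y e
  pow-cancel e k = begin
    pow y (e + k) Q.* pow B k              ≡⟨ cong (Q._* pow B k) (pow-+ y e k) ⟩
    pow y e Q.* pow y k Q.* pow B k        ≡⟨ QP.*-assoc (pow y e) (pow y k) (pow B k) ⟩
    pow y e Q.* (pow y k Q.* pow B k)      ≡⟨ cong (pow y e Q.*_) (pow-inverse y B y·B≡1 k) ⟩
    pow y e Q.* 1ℚ                         ≡⟨ QP.*-identityʳ (pow y e) ⟩
    pow y e                                ∎

  ℕ→ℚ-divmod : ∀ t → ℕ→ℚ t ≡ ℕ→ℚ (t N.% b) Q.+ ℕ→ℚ (t N./ b) Q.* B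
  ℕ→ℚ-divmod t = trans (cong ℕ→ℚ (DM.m≡m%n+[m/n]*n t b))
    (trans (ℕ→ℚ-+ (t N.% b) _) (cong (ℕ→ℚ (t N.% b) Q.+_) (ℕ→ℚ-* (t N./ b) b)))

  quotient-sum : ∀ t → addDigit (λ s → ℕ→ℚ (s N./ b)) t ≡ ℕ→ℚ t
  quotient-sum t = begin
    addDigit (λ s → ℕ→ℚ (s N./ b)) t         ≡⟨ digit-quotients ℕ→ℚ t ⟩
    ℕ→ℚ (b ∸ ρ) Q.* Q′ Q.+ R Q.* ℕ→ℚ (suc q)
      ≡⟨ cong₂ (λ x z → x Q.* Q′ Q.+ R Q.* z) (ℕ→ℚ-∸ b ρ (NP.<⇒≤ (DM.m%n<n t b))) (ℕ→ℚ-+ 1 q) ⟩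
    (B Q.- R) Q.* Q′ Q.+ R Q.* (1ℚ Q.+ Q′)   ≡⟨ solve 3 (λ B R Q → (B :- R) :* Q :+ R :* (con 1ℚ :+ Q) := R :+ Q :* B) refl B R Q′ ⟩
    R Q.+ Q′ Q.* B                           ≡⟨ sym (ℕ→ℚ-divmod t) ⟩
    ℕ→ℚ t                                    ∎
    where
      ρ = t N.% b
      q = t N./ b
      R = ℕ→ℚ ρ
      Q′ = ℕ→ℚ q

  -- The defect ρ(b-ρ), ρ = t mod b, in the corresponding identity for squares.
  spread : ℕ → ℚ
  spread t = ℕ→ℚ (t N.% b) Q.* (B Q.- ℕ→ℚ (t N.% b))

  quotient-square-sum : ∀ t → addDigit (λ s → ℕ→ℚ (s N./ b) Q.* ℕ→ℚ (s N./ b)) t ≡ y Q.* (ℕ→ℚ t Q.* ℕ→ℚ t Q.+ spread t)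
  quotient-square-sum t = begin
    addDigit (λ s → ℕ→ℚ (s N./ b) Q.* ℕ→ℚ (s N./ b)) t ≡⟨ digit-quotients (λ q → ℕ→ℚ q Q.* ℕ→ℚ q) t ⟩
    ℕ→ℚ (b ∸ ρ) Q.* (Q′ Q.* Q′) Q.+ R Q.* (ℕ→ℚ (suc q) Q.* ℕ→ℚ (suc q))
      ≡⟨ cong₂ (λ x z → x Q.* (Q′ Q.* Q′) Q.+ R Q.* (z Q.* z)) (ℕ→ℚ-∸ b ρ (NP.<⇒≤ (DM.m%n<n t b))) (ℕ→ℚ-+ 1 q) ⟩
    X                                                   ≡⟨ sym (QP.*-identityˡ X) ⟩
    1ℚ Q.* X                                            ≡⟨ cong (Q._* X) (sym y·B≡1) ⟩
    (y Q.* B) Q.* X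
      ≡⟨ solve 4 (λ y B R Q → (y :* B) :* ((B :- R) :* (Q :* Q) :+ R :* ((con 1ℚ :+ Q) :* (con 1ℚ :+ Q)))
                := y :* ((R :+ Q :* B) :* (R :+ Q :* B) :+ R :* (B :- R))) refl y B R Q′ ⟩
    y Q.* ((R Q.+ Q′ Q.* B) Q.* (R Q.+ Q′ Q.* B) Q.+ spread t) ≡⟨ cong (λ x → y Q.* (x Q.* x Q.+ spread t)) (sym (ℕ→ℚ-divmod t)) ⟩
    y Q.* (ℕ→ℚ t Q.* ℕ→ℚ t Q.+ spread t)                ∎
    where
      ρ = t N.% b
      q = t N./ b
      R = ℕ→ℚ ρ
      Q′ = ℕ→ℚ q
      X = (B Q.- R) Q.* (Q′ Q.* Q′) Q.+ R Q.* ((1ℚ Q.+ Q′) Q.* (1ℚ Q.+ Q′))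

  spread-sum : ∀ t → addDigit spread t ≡ B Q.* (B Q.* B Q.- 1ℚ) Q.* ⅙
  spread-sum t = begin
    addDigit spread t                                ≡⟨ digit-remainders (λ r → ℕ→ℚ r Q.* (B Q.- ℕ→ℚ r)) t ⟩
    ∑ b (λ r → ℕ→ℚ r Q.* (B Q.- ℕ→ℚ r))
      ≡⟨ ∑-ext b (λ r → solve 2 (λ x B → x :* (B :- x) := con (Q.- 1ℚ) :* x :* x :+ B :* x :+ con 0ℚ) refl (ℕ→ℚ r) B) ⟩
    ∑ b (λ r → Q.- 1ℚ Q.* ℕ→ℚ r Q.* ℕ→ℚ r Q.+ B Q.* ℕ→ℚ r Q.+ 0ℚ) ≡⟨ ∑-quadratic b (Q.- 1ℚ) B 0ℚ ⟩
    Q.- 1ℚ Q.* pyramidal B Q.+ B Q.* triangular B Q.+ 0ℚ Q.* B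
      ≡⟨ solve 1 (λ B → con (Q.- 1ℚ) :* (B :* (B :- con 1ℚ) :* (B :+ B :- con 1ℚ) :* con ⅙) :+ B :* (B :* (B :- con 1ℚ) :* con ½) :+ con 0ℚ :* B
                      := B :* (B :* B :- con 1ℚ) :* con ⅙) refl B ⟩
    B Q.* (B Q.* B Q.- 1ℚ) Q.* ⅙                     ∎

  meanₙ : ℕ → ℚ
  meanₙ n = (+ (n ∸ 1)) / 2

  varₙ : ℕ → ℚ
  varₙ n = (+ (n + 1)) / 12

  M-row-sum : ∀ n i → i < n → ∑ n (M b n i) ≡ 1ℚ
  M-row-sum n i i<n = begin
    ∑ n (M b n i)                                  ≡⟨ ∑-ext n (λ j → sym (QP.*-identityʳ (M b n i j))) ⟩
    ∑ n (λ j → M b n i j Q.* 1ℚ)                   ≡⟨ M-moment n i (λ _ → 1ℚ) i<n ⟩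
    pow y n Q.* overDigits n (λ _ → 1ℚ) i          ≡⟨ cong (pow y n Q.*_) (overDigits-const n 1ℚ i) ⟩
    pow y n Q.* (pow B n Q.* 1ℚ)                   ≡⟨ cong (pow y n Q.*_) (QP.*-identityʳ (pow B n)) ⟩
    pow y n Q.* pow B n                            ≡⟨ pow-inverse y B y·B≡1 n ⟩
    1ℚ                                             ∎

  M-row-mean : ∀ n i → i < n → ∑ n (λ j → M b n i j Q.* ℕ→ℚ j) ≡ y Q.* ℕ→ℚ i Q.+ meanₙ n Q.* (1ℚ Q.- y)
  M-row-mean (suc m) i i<n = begin
    ∑ (suc m) (λ j → M b (suc m) i j Q.* ℕ→ℚ j)           ≡⟨ M-moment (suc m) i ℕ→ℚ i<n ⟩
    pow y (suc m) Q.* overDigits m (addDigit (λ s → ℕ→ℚ (s N./ b))) i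
      ≡⟨ cong (pow y (suc m) Q.*_) (trans (overDigits-cong m quotient-sum i) (overDigits-linear m i)) ⟩
    pow y (1 + m) Q.* (pow B m Q.* W)                      ≡⟨ sym (QP.*-assoc (pow y (1 + m)) (pow B m) W) ⟩
    pow y (1 + m) Q.* pow B m Q.* W                        ≡⟨ cong (Q._* W) (pow-cancel 1 m) ⟩
    y Q.* 1ℚ Q.* W
      ≡⟨ solve 4 (λ y I M B → y :* con 1ℚ :* (I :+ M :* ((B :- con 1ℚ) :* con ½)) := y :* I :+ M :* con ½ :* (y :* B :- y)) refl y I Mq B ⟩
    y Q.* I Q.+ Mq Q.* ½ Q.* (y Q.* B Q.- y)               ≡⟨ cong (λ e → y Q.* I Q.+ Mq Q.* ½ Q.* (e Q.- y)) y·B≡1 ⟩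
    y Q.* I Q.+ Mq Q.* ½ Q.* (1ℚ Q.- y)                    ≡⟨ cong (λ x → y Q.* I Q.+ x Q.* (1ℚ Q.- y)) (sym (/-as-* (+ m) 2)) ⟩
    y Q.* I Q.+ meanₙ (suc m) Q.* (1ℚ Q.- y)               ∎
    where
      I = ℕ→ℚ i
      Mq = ℕ→ℚ m
      W = I Q.+ Mq Q.* μ

  -- Σ over m+2 digits of ⌊(i + Σd)/b⌋²: summing out the last digit leaves
  -- (t² + spread t)/b, and the spread term is constant after one more digit.
  carry-square-sum : ∀ m′ i → let m = suc m′ ; W = ℕ→ℚ i Q.+ ℕ→ℚ m Q.* μ in
    overDigits (suc m) (λ t → ℕ→ℚ (t N./ b) Q.* ℕ→ℚ (t N./ b)) i
    ≡ y Q.* (pow B m Q.* (W Q.* W Q.+ ℕ→ℚ m Q.* σ²) Q.+ pow B m′ Q.* (B Q.* (B Q.* B Q.- 1ℚ) Q.* ⅙))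
  carry-square-sum m′ i = begin
    overDigits m (addDigit (λ s → ℕ→ℚ (s N./ b) Q.* ℕ→ℚ (s N./ b))) i
      ≡⟨ overDigits-cong m quotient-square-sum i ⟩
    overDigits m (λ t → y Q.* (ℕ→ℚ t Q.* ℕ→ℚ t Q.+ spread t)) i
      ≡⟨ trans (overDigits-*ˡ m y (λ t → ℕ→ℚ t Q.* ℕ→ℚ t Q.+ spread t) i)
               (cong (y Q.*_) (overDigits-+ m (λ t → ℕ→ℚ t Q.* ℕ→ℚ t) spread i)) ⟩
    y Q.* (overDigits m (λ t → ℕ→ℚ t Q.* ℕ→ℚ t) i Q.+ overDigits m′ (addDigit spread) i)
      ≡⟨ cong₂ (λ u w → y Q.* (u Q.+ w)) (overDigits-square m i)
               (trans (overDigits-cong m′ spread-sum i) (overDigits-const m′ _ i)) ⟩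
    y Q.* (pow B m Q.* (W Q.* W Q.+ ℕ→ℚ m Q.* σ²) Q.+ pow B m′ Q.* (B Q.* (B Q.* B Q.- 1ℚ) Q.* ⅙)) ∎
    where
      m = suc m′
      W = ℕ→ℚ i Q.+ ℕ→ℚ m Q.* μ

  -- The algebra behind M-row-square: since y·b = 1,
  -- y²((I + mμ)² + mσ²) + y³ b(b²-1)/6 = (yI + (m/2)(1-y))² + ((m+2)/12)(1-y²).
  square-identity : ∀ I Mq →
    y Q.* (y Q.* 1ℚ) Q.* ((I Q.+ Mq Q.* μ) Q.* (I Q.+ Mq Q.* μ) Q.+ Mq Q.* σ²)
      Q.+ y Q.* (y Q.* (y Q.* 1ℚ)) Q.* (B Q.* (B Q.* B Q.- 1ℚ) Q.* ⅙)
    ≡ (y Q.* I Q.+ Mq Q.* ½ Q.* (1ℚ Q.- y)) Q.* (y Q.* I Q.+ Mq Q.* ½ Q.* (1ℚ Q.- y))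
      Q.+ (Mq Q.+ ℕ→ℚ 2) Q.* 1/12 Q.* (1ℚ Q.- y Q.* y)
  square-identity I Mq = begin
    _ ≡⟨ solve 4 (λ y I M B →
           y :* (y :* con 1ℚ) :* ((I :+ M :* ((B :- con 1ℚ) :* con ½)) :* (I :+ M :* ((B :- con 1ℚ) :* con ½))
                                  :+ M :* ((B :* B :- con 1ℚ) :* con 1/12))
           :+ y :* (y :* (y :* con 1ℚ)) :* (B :* (B :* B :- con 1ℚ) :* con ⅙)
           := (y :* I :+ M :* con ½ :* (y :* B :- y)) :* (y :* I :+ M :* con ½ :* (y :* B :- y))
              :+ M :* ((y :* B) :* (y :* B) :- y :* y) :* con 1/12 :+ (y :* B) :* ((y :* B) :* (y :* B) :- y :* y) :* con ⅙)
           refl y I Mq B ⟩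
    G (y Q.* B) ≡⟨ cong G y·B≡1 ⟩
    G 1ℚ        ≡⟨ solve 3 (λ y I M →
                     (y :* I :+ M :* con ½ :* (con 1ℚ :- y)) :* (y :* I :+ M :* con ½ :* (con 1ℚ :- y))
                     :+ M :* (con 1ℚ :* con 1ℚ :- y :* y) :* con 1/12 :+ con 1ℚ :* (con 1ℚ :* con 1ℚ :- y :* y) :* con ⅙
                     := (y :* I :+ M :* con ½ :* (con 1ℚ :- y)) :* (y :* I :+ M :* con ½ :* (con 1ℚ :- y))
                        :+ (M :+ con (ℕ→ℚ 2)) :* con 1/12 :* (con 1ℚ :- y :* y)) refl y I Mq ⟩
    _ ∎
    where
      -- the left-hand side as a polynomial in y and e = y·b
      G : ℚ → ℚ
      G e = (y Q.* I Q.+ Mq Q.* ½ Q.* (e Q.- y)) Q.* (y Q.* I Q.+ Mq Q.* ½ Q.* (e Q.- y))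
            Q.+ Mq Q.* (e Q.* e Q.- y Q.* y) Q.* 1/12 Q.+ e Q.* (e Q.* e Q.- y Q.* y) Q.* ⅙

  M-row-square : ∀ n → 2 ≤ n → ∀ i → i < n →
    ∑ n (λ j → M b n i j Q.* (ℕ→ℚ j Q.* ℕ→ℚ j))
    ≡ (y Q.* ℕ→ℚ i Q.+ meanₙ n Q.* (1ℚ Q.- y)) Q.* (y Q.* ℕ→ℚ i Q.+ meanₙ n Q.* (1ℚ Q.- y))
      Q.+ varₙ n Q.* (1ℚ Q.- y Q.* y)
  M-row-square (suc (suc m′)) (s≤s (s≤s _)) i i<n = begin
    ∑ n (λ j → M b n i j Q.* (ℕ→ℚ j Q.* ℕ→ℚ j))
      ≡⟨ trans (M-moment n i (λ j → ℕ→ℚ j Q.* ℕ→ℚ j) i<n) (cong (pow y n Q.*_) (carry-square-sum m′ i)) ⟩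
    pow y n Q.* (y Q.* (pow B m Q.* S₂ Q.+ pow B m′ Q.* κ))
      ≡⟨ solve 6 (λ P y p₁ p₂ S K → P :* (y :* (p₁ :* S :+ p₂ :* K)) := y :* (P :* p₁) :* S :+ y :* (P :* p₂) :* K)
                 refl (pow y n) y (pow B m) (pow B m′) S₂ κ ⟩
    y Q.* (pow y (1 + m) Q.* pow B m) Q.* S₂ Q.+ y Q.* (pow y (2 + m′) Q.* pow B m′) Q.* κ
      ≡⟨ cong₂ (λ u w → y Q.* u Q.* S₂ Q.+ y Q.* w Q.* κ) (pow-cancel 1 m) (pow-cancel 2 m′) ⟩
    y Q.* (y Q.* 1ℚ) Q.* S₂ Q.+ y Q.* (y Q.* (y Q.* 1ℚ)) Q.* κ
      ≡⟨ square-identity I Mq ⟩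
    (y Q.* I Q.+ Mq Q.* ½ Q.* (1ℚ Q.- y)) Q.* (y Q.* I Q.+ Mq Q.* ½ Q.* (1ℚ Q.- y))
      Q.+ (Mq Q.+ ℕ→ℚ 2) Q.* 1/12 Q.* (1ℚ Q.- y Q.* y)
      ≡⟨ cong₂ (λ u w → (y Q.* I Q.+ u Q.* (1ℚ Q.- y)) Q.* (y Q.* I Q.+ u Q.* (1ℚ Q.- y)) Q.+ w Q.* (1ℚ Q.- y Q.* y))
               (sym (/-as-* (+ m) 2)) (sym var-as-*) ⟩
    (y Q.* I Q.+ meanₙ n Q.* (1ℚ Q.- y)) Q.* (y Q.* I Q.+ meanₙ n Q.* (1ℚ Q.- y)) Q.+ varₙ n Q.* (1ℚ Q.- y Q.* y) ∎
    where
      m = suc m′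
      n = suc m
      I = ℕ→ℚ i
      Mq = ℕ→ℚ m
      S₂ = (I Q.+ Mq Q.* μ) Q.* (I Q.+ Mq Q.* μ) Q.+ Mq Q.* σ²
      κ = B Q.* (B Q.* B Q.- 1ℚ) Q.* ⅙
      var-as-* : varₙ n ≡ (Mq Q.+ ℕ→ℚ 2) Q.* 1/12
      var-as-* = trans (/-as-* (+ (n + 1)) 12)
        (cong (Q._* 1/12) (trans (cong ℕ→ℚ (NP.+-comm n 1)) (trans (ℕ→ℚ-+ 2 m) (QP.+-comm (ℕ→ℚ 2) Mq))))

module AffineChain
  (n : ℕ) (0<n : 0 < n) (K : ℕ → ℕ → ℚ) (Kʳ : ℕ → ℕ → ℕ → ℚ)
  (Kʳ-zero : ∀ i (w : ℕ → ℚ) → i < n → ∑ n (λ j → Kʳ 0 i j Q.* w j) ≡ w i)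
  (Kʳ-suc : ∀ r i j → Kʳ (suc r) i j ≡ ∑ n (λ k → Kʳ r i k Q.* K k j))
  (y μ v : ℚ)
  (row-sum : ∀ i → i < n → ∑ n (K i) ≡ 1ℚ)
  (row-mean : ∀ i → i < n → ∑ n (λ j → K i j Q.* ℕ→ℚ j) ≡ y Q.* ℕ→ℚ i Q.+ μ Q.* (1ℚ Q.- y))
  (row-square : ∀ i → i < n → ∑ n (λ j → K i j Q.* (ℕ→ℚ j Q.* ℕ→ℚ j))
                ≡ (y Q.* ℕ→ℚ i Q.+ μ Q.* (1ℚ Q.- y)) Q.* (y Q.* ℕ→ℚ i Q.+ μ Q.* (1ℚ Q.- y)) Q.+ v Q.* (1ℚ Q.- y Q.* y))
  where

  step : ∀ r i (w : ℕ → ℚ) → ∑ n (λ j → Kʳ (suc r) i j Q.* w j) ≡ ∑ n (λ k → Kʳ r i k Q.* ∑ n (λ j → K k j Q.* w j))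
  step r i w = begin
    ∑ n (λ j → Kʳ (suc r) i j Q.* w j)
      ≡⟨ ∑-ext n (λ j → trans (cong (Q._* w j) (Kʳ-suc r i j)) (sym (∑-*ʳ n (w j) (λ k → Kʳ r i k Q.* K k j)))) ⟩
    ∑ n (λ j → ∑ n (λ k → Kʳ r i k Q.* K k j Q.* w j))
      ≡⟨ ∑-swap n n (λ j k → Kʳ r i k Q.* K k j Q.* w j) ⟩
    ∑ n (λ k → ∑ n (λ j → Kʳ r i k Q.* K k j Q.* w j))
      ≡⟨ ∑-ext n (λ k → trans (∑-ext n (λ j → QP.*-assoc (Kʳ r i k) (K k j) (w j))) (∑-*ˡ n (Kʳ r i k) (λ j → K k j Q.* w j))) ⟩
    ∑ n (λ k → Kʳ r i k Q.* ∑ n (λ j → K k j Q.* w j)) ∎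

  step-with : ∀ r i (w : ℕ → ℚ) (g : ℕ → ℚ) → (∀ k → k < n → ∑ n (λ j → K k j Q.* w j) ≡ g k) →
              ∑ n (λ j → Kʳ (suc r) i j Q.* w j) ≡ ∑ n (λ k → Kʳ r i k Q.* g k)
  step-with r i w g rows = trans (step r i w) (∑-cong n (λ k k<n → cong (Kʳ r i k Q.*_) (rows k k<n)))

  mass : ∀ r i → i < n → ∑ n (Kʳ r i) ≡ 1ℚ
  mass r i i<n = trans (∑-ext n (λ j → sym (QP.*-identityʳ (Kʳ r i j)))) (go r)
    where
      go : ∀ r → ∑ n (λ j → Kʳ r i j Q.* 1ℚ) ≡ 1ℚ
      go zero    = Kʳ-zero i (λ _ → 1ℚ) i<n
      go (suc r) = trans (step-with r i (λ _ → 1ℚ) (λ _ → 1ℚ)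
                            (λ k k<n → trans (∑-ext n (λ j → QP.*-identityʳ (K k j))) (row-sum k k<n)))
                         (go r)

  conditional-mean : ∀ r i → i < n → ∑ n (λ j → Kʳ r i j Q.* ℕ→ℚ j) ≡ pow y r Q.* ℕ→ℚ i Q.+ μ Q.* (1ℚ Q.- pow y r)
  conditional-mean zero i i<n = trans (Kʳ-zero i ℕ→ℚ i<n)
    (solve 2 (λ I μ → I := con 1ℚ :* I :+ μ :* (con 1ℚ :- con 1ℚ)) refl (ℕ→ℚ i) μ)
  conditional-mean (suc r) i i<n = begin
    ∑ n (λ j → Kʳ (suc r) i j Q.* ℕ→ℚ j)         ≡⟨ step-with r i ℕ→ℚ (λ k → y Q.* ℕ→ℚ k Q.+ c) row-mean ⟩
    ∑ n (λ k → Kʳ r i k Q.* (y Q.* ℕ→ℚ k Q.+ c)) ≡⟨ ∑-affine n (Kʳ r i) y c ⟩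
    y Q.* ∑ n (λ k → Kʳ r i k Q.* ℕ→ℚ k) Q.+ c Q.* ∑ n (Kʳ r i)
      ≡⟨ cong₂ (λ u w → y Q.* u Q.+ c Q.* w) (conditional-mean r i i<n) (mass r i i<n) ⟩
    y Q.* (pow y r Q.* ℕ→ℚ i Q.+ μ Q.* (1ℚ Q.- pow y r)) Q.+ c Q.* 1ℚ
      ≡⟨ solve 4 (λ y x I μ → y :* (x :* I :+ μ :* (con 1ℚ :- x)) :+ μ :* (con 1ℚ :- y) :* con 1ℚ
                             := (y :* x) :* I :+ μ :* (con 1ℚ :- y :* x)) refl y (pow y r) (ℕ→ℚ i) μ ⟩
    pow y (suc r) Q.* ℕ→ℚ i Q.+ μ Q.* (1ℚ Q.- pow y (suc r)) ∎
    where c = μ Q.* (1ℚ Q.- y)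

  mean : ℕ → ℚ
  mean r = ∑ n (λ j → Kʳ r 0 j Q.* ℕ→ℚ j)

  second : ℕ → ℚ
  second r = ∑ n (λ j → Kʳ r 0 j Q.* ℕ→ℚ j Q.* ℕ→ℚ j)

  joint : ℕ → ℕ → ℚ
  joint s r = ∑ n (λ i → ∑ n (λ j → Kʳ s 0 i Q.* Kʳ r i j Q.* ℕ→ℚ i Q.* ℕ→ℚ j))

  mean-formula : ∀ r → mean r ≡ (1ℚ Q.- pow y r) Q.* μ
  mean-formula r = trans (conditional-mean r 0 0<n)
    (solve 2 (λ x μ → x :* con 0ℚ :+ μ :* (con 1ℚ :- x) := (con 1ℚ :- x) :* μ) refl (pow y r) μ)

  second-formula : ∀ r → second r ≡ mean r Q.* mean r Q.+ (1ℚ Q.- pow y r Q.* pow y r) Q.* v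
  second-formula zero = begin
    second 0                    ≡⟨ ∑-ext n (λ j → QP.*-assoc (Kʳ 0 0 j) (ℕ→ℚ j) (ℕ→ℚ j)) ⟩
    ∑ n (λ j → Kʳ 0 0 j Q.* (ℕ→ℚ j Q.* ℕ→ℚ j)) ≡⟨ Kʳ-zero 0 (λ j → ℕ→ℚ j Q.* ℕ→ℚ j) 0<n ⟩
    0ℚ                          ≡⟨ solve 1 (λ v → con 0ℚ := con 0ℚ :* con 0ℚ :+ (con 1ℚ :- con 1ℚ :* con 1ℚ) :* v) refl v ⟩
    0ℚ Q.* 0ℚ Q.+ (1ℚ Q.- 1ℚ Q.* 1ℚ) Q.* v ≡⟨ cong (λ e → e Q.* e Q.+ (1ℚ Q.- 1ℚ Q.* 1ℚ) Q.* v) (sym (Kʳ-zero 0 ℕ→ℚ 0<n)) ⟩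
    mean 0 Q.* mean 0 Q.+ (1ℚ Q.- 1ℚ Q.* 1ℚ) Q.* v ∎
  second-formula (suc r) = begin
    second (suc r)              ≡⟨ ∑-ext n (λ j → QP.*-assoc (Kʳ (suc r) 0 j) (ℕ→ℚ j) (ℕ→ℚ j)) ⟩
    ∑ n (λ j → Kʳ (suc r) 0 j Q.* (ℕ→ℚ j Q.* ℕ→ℚ j))
      ≡⟨ step-with r 0 (λ j → ℕ→ℚ j Q.* ℕ→ℚ j) (λ k → (y Q.* ℕ→ℚ k Q.+ c) Q.* (y Q.* ℕ→ℚ k Q.+ c) Q.+ v′) row-square ⟩
    ∑ n (λ k → Kʳ r 0 k Q.* ((y Q.* ℕ→ℚ k Q.+ c) Q.* (y Q.* ℕ→ℚ k Q.+ c) Q.+ v′)) ≡⟨ ∑-square n (Kʳ r 0) y c v′ ⟩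
    y Q.* y Q.* second r Q.+ ℕ→ℚ 2 Q.* y Q.* c Q.* mean r Q.+ (c Q.* c Q.+ v′) Q.* ∑ n (Kʳ r 0)
      ≡⟨ cong₂ (λ u w → y Q.* y Q.* u Q.+ ℕ→ℚ 2 Q.* y Q.* c Q.* mean r Q.+ (c Q.* c Q.+ v′) Q.* w)
               (second-formula r) (mass r 0 0<n) ⟩
    y Q.* y Q.* (mean r Q.* mean r Q.+ (1ℚ Q.- pow y r Q.* pow y r) Q.* v) Q.+ ℕ→ℚ 2 Q.* y Q.* c Q.* mean r Q.+ (c Q.* c Q.+ v′) Q.* 1ℚ
      ≡⟨ cong₂ (λ u w → y Q.* y Q.* (u Q.* u Q.+ (1ℚ Q.- pow y r Q.* pow y r) Q.* v) Q.+ ℕ→ℚ 2 Q.* y Q.* c Q.* w Q.+ (c Q.* c Q.+ v′) Q.* 1ℚ)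
               (mean-formula r) (mean-formula r) ⟩
    y Q.* y Q.* (Eʳ Q.* Eʳ Q.+ (1ℚ Q.- pow y r Q.* pow y r) Q.* v) Q.+ ℕ→ℚ 2 Q.* y Q.* c Q.* Eʳ Q.+ (c Q.* c Q.+ v′) Q.* 1ℚ
      ≡⟨ solve 4 (λ y x μ v →
           y :* y :* ((con 1ℚ :- x) :* μ :* ((con 1ℚ :- x) :* μ) :+ (con 1ℚ :- x :* x) :* v)
           :+ con (ℕ→ℚ 2) :* y :* (μ :* (con 1ℚ :- y)) :* ((con 1ℚ :- x) :* μ)
           :+ ((μ :* (con 1ℚ :- y)) :* (μ :* (con 1ℚ :- y)) :+ v :* (con 1ℚ :- y :* y)) :* con 1ℚ
           := (con 1ℚ :- y :* x) :* μ :* ((con 1ℚ :- y :* x) :* μ) :+ (con 1ℚ :- (y :* x) :* (y :* x)) :* v)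
           refl y (pow y r) μ v ⟩
    Eʳ⁺ Q.* Eʳ⁺ Q.+ (1ℚ Q.- pow y (suc r) Q.* pow y (suc r)) Q.* v
      ≡⟨ cong (λ e → e Q.* e Q.+ (1ℚ Q.- pow y (suc r) Q.* pow y (suc r)) Q.* v) (sym (mean-formula (suc r))) ⟩
    mean (suc r) Q.* mean (suc r) Q.+ (1ℚ Q.- pow y (suc r) Q.* pow y (suc r)) Q.* v ∎
    where
      c = μ Q.* (1ℚ Q.- y)
      v′ = v Q.* (1ℚ Q.- y Q.* y)
      Eʳ = (1ℚ Q.- pow y r) Q.* μ
      Eʳ⁺ = (1ℚ Q.- pow y (suc r)) Q.* μ

  -- E(κ_s κ_{s+r}) = yʳ E(κ_s²) + μ(1 - yʳ) E(κ_s), by conditioning on κ_s.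
  joint-formula : ∀ s r → joint s r ≡ pow y r Q.* second s Q.+ μ Q.* (1ℚ Q.- pow y r) Q.* mean s
  joint-formula s r = begin
    joint s r
      ≡⟨ ∑-cong n (λ i i<n → trans (∑-ext n (λ j → solve 4 (λ p m I J → p :* m :* I :* J := (p :* I) :* (m :* J)) refl
                                                        (Kʳ s 0 i) (Kʳ r i j) (ℕ→ℚ i) (ℕ→ℚ j)))
                             (trans (∑-*ˡ n (Kʳ s 0 i Q.* ℕ→ℚ i) (λ j → Kʳ r i j Q.* ℕ→ℚ j))
                                    (cong (Kʳ s 0 i Q.* ℕ→ℚ i Q.*_) (conditional-mean r i i<n)))) ⟩
    ∑ n (λ i → Kʳ s 0 i Q.* ℕ→ℚ i Q.* (pow y r Q.* ℕ→ℚ i Q.+ c))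
      ≡⟨ ∑-ext n (λ i → solve 4 (λ p I x c → p :* I :* (x :* I :+ c) := x :* (p :* I :* I) :+ c :* (p :* I)) refl
                                 (Kʳ s 0 i) (ℕ→ℚ i) (pow y r) c) ⟩
    ∑ n (λ i → pow y r Q.* (Kʳ s 0 i Q.* ℕ→ℚ i Q.* ℕ→ℚ i) Q.+ c Q.* (Kʳ s 0 i Q.* ℕ→ℚ i))
      ≡⟨ trans (∑-+ n _ _) (cong₂ Q._+_ (∑-*ˡ n (pow y r) _) (∑-*ˡ n c _)) ⟩
    pow y r Q.* second s Q.+ c Q.* mean s ∎
    where c = μ Q.* (1ℚ Q.- pow y r)

  pow-double : ∀ r → pow y (2 * r) ≡ pow y r Q.* pow y r
  pow-double r = trans (pow-+ y r (r + 0)) (cong (λ k → pow y r Q.* pow y k) (NP.+-identityʳ r))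

  variance-formula : ∀ r → second r Q.- mean r Q.* mean r ≡ (1ℚ Q.- pow y (2 * r)) Q.* v
  variance-formula r = begin
    second r Q.- mean r Q.* mean r
      ≡⟨ cong (Q._- mean r Q.* mean r) (second-formula r) ⟩
    mean r Q.* mean r Q.+ (1ℚ Q.- pow y r Q.* pow y r) Q.* v Q.- mean r Q.* mean r
      ≡⟨ solve 3 (λ e x v → e :* e :+ (con 1ℚ :- x :* x) :* v :- e :* e := (con 1ℚ :- x :* x) :* v) refl (mean r) (pow y r) v ⟩
    (1ℚ Q.- pow y r Q.* pow y r) Q.* v    ≡⟨ cong (λ x → (1ℚ Q.- x) Q.* v) (sym (pow-double r)) ⟩
    (1ℚ Q.- pow y (2 * r)) Q.* v          ∎

  covariance-formula : ∀ s r → joint s r Q.- mean s Q.* mean (s + r) ≡ pow y r Q.* v Q.* (1ℚ Q.- pow y (2 * s))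
  covariance-formula s r = begin
    joint s r Q.- mean s Q.* mean (s + r)
      ≡⟨ cong₂ (λ u w → u Q.- mean s Q.* w) (joint-formula s r) (mean-formula (s + r)) ⟩
    pow y r Q.* second s Q.+ μ Q.* (1ℚ Q.- pow y r) Q.* mean s Q.- mean s Q.* ((1ℚ Q.- pow y (s + r)) Q.* μ)
      ≡⟨ cong₂ (λ u w → pow y r Q.* u Q.+ μ Q.* (1ℚ Q.- pow y r) Q.* mean s Q.- mean s Q.* ((1ℚ Q.- w) Q.* μ))
               (second-formula s) (pow-+ y s r) ⟩
    pow y r Q.* (mean s Q.* mean s Q.+ (1ℚ Q.- pow y s Q.* pow y s) Q.* v)
      Q.+ μ Q.* (1ℚ Q.- pow y r) Q.* mean s Q.- mean s Q.* ((1ℚ Q.- pow y s Q.* pow y r) Q.* μ)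
      ≡⟨ cong (λ e → pow y r Q.* (e Q.* e Q.+ (1ℚ Q.- pow y s Q.* pow y s) Q.* v)
                     Q.+ μ Q.* (1ℚ Q.- pow y r) Q.* e Q.- e Q.* ((1ℚ Q.- pow y s Q.* pow y r) Q.* μ)) (mean-formula s) ⟩
    pow y r Q.* (Eˢ Q.* Eˢ Q.+ (1ℚ Q.- pow y s Q.* pow y s) Q.* v)
      Q.+ μ Q.* (1ℚ Q.- pow y r) Q.* Eˢ Q.- Eˢ Q.* ((1ℚ Q.- pow y s Q.* pow y r) Q.* μ)
      ≡⟨ solve 4 (λ xs xr μ v →
           xr :* ((con 1ℚ :- xs) :* μ :* ((con 1ℚ :- xs) :* μ) :+ (con 1ℚ :- xs :* xs) :* v)
           :+ μ :* (con 1ℚ :- xr) :* ((con 1ℚ :- xs) :* μ) :- (con 1ℚ :- xs) :* μ :* ((con 1ℚ :- xs :* xr) :* μ)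
           := xr :* v :* (con 1ℚ :- xs :* xs)) refl (pow y s) (pow y r) μ v ⟩
    pow y r Q.* v Q.* (1ℚ Q.- pow y s Q.* pow y s) ≡⟨ cong (λ x → pow y r Q.* v Q.* (1ℚ Q.- x)) (sym (pow-double s)) ⟩
    pow y r Q.* v Q.* (1ℚ Q.- pow y (2 * s))       ∎
    where Eˢ = (1ℚ Q.- pow y s) Q.* μ

Mpow-zero : ∀ b n .{{_ : NonZero b}} i (w : ℕ → ℚ) → i < n → ∑ n (λ j → Mpow b n 0 i j Q.* w j) ≡ w i
Mpow-zero b n i w i<n = trans (∑-single n i _ i<n off-diagonal) (trans (cong (Q._* w i) diagonal) (QP.*-identityˡ (w i)))
  where
    diagonal : Mpow b n 0 i i ≡ 1ℚ
    diagonal with i N.≟ i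
    ... | yes _   = refl
    ... | no i≢i = ⊥-elim (i≢i refl)
    off-diagonal : ∀ j → j ≢ i → Mpow b n 0 i j Q.* w j ≡ 0ℚ
    off-diagonal j j≢i with i N.≟ j
    ... | yes i≡j = ⊥-elim (j≢i (sym i≡j))
    ... | no _    = QP.*-zeroˡ (w j)

Mpow-suc : ∀ b n .{{_ : NonZero b}} r i j → Mpow b n (suc r) i j ≡ ∑ n (λ k → Mpow b n r i k Q.* M b n k j)
Mpow-suc b n r i j = Σℚ-upTo n (λ k → Mpow b n r i k Q.* M b n k j)

module CarriesChain (b n : ℕ) .{{_ : NonZero b}} (2≤n : 2 ≤ n) where
  open Digits b using (y)
  open DigitMoments b
  open AffineChain n (NP.<-trans (s≤s z≤n) 2≤n) (M b n) (Mpow b n) (Mpow-zero b n) (Mpow-suc b n)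
                   y (meanₙ n) (varₙ n) (M-row-sum n) (M-row-mean n) (M-row-square n 2≤n)

  E≡mean : ∀ r → E b n r ≡ mean r
  E≡mean r = Σℚ-upTo n (λ j → Mpow b n r 0 j Q.* ℕ→ℚ j)

  expectation : ∀ r → E b n r ≡ (1ℚ - invPow b r) *ℚ meanₙ n
  expectation r = begin
    E b n r                           ≡⟨ E≡mean r ⟩
    mean r                            ≡⟨ mean-formula r ⟩
    (1ℚ - pow y r) *ℚ meanₙ n         ≡⟨ cong (λ x → (1ℚ - x) *ℚ meanₙ n) (sym (1/^ b r)) ⟩
    (1ℚ - invPow b r) *ℚ meanₙ n      ∎

  variance : ∀ r → Var b n r ≡ (1ℚ - invPow b (2 * r)) *ℚ varₙ n
  variance r = begin
    Var b n r                               ≡⟨ cong₂ (λ u e → u - e *ℚ e) (Σℚ-upTo n _) (E≡mean r) ⟩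
    second r - mean r *ℚ mean r             ≡⟨ variance-formula r ⟩
    (1ℚ - pow y (2 * r)) *ℚ varₙ n          ≡⟨ cong (λ x → (1ℚ - x) *ℚ varₙ n) (sym (1/^ b (2 * r))) ⟩
    (1ℚ - invPow b (2 * r)) *ℚ varₙ n       ∎

  covariance : ∀ s r → Cov b n s r ≡ invPow b r *ℚ varₙ n *ℚ (1ℚ - invPow b (2 * s))
  covariance s r = begin
    Cov b n s r
      ≡⟨ cong₂ (λ u e → u - e) (trans (Σℚ-upTo n _) (∑-ext n (λ i → Σℚ-upTo n _)))
                                (cong₂ _*ℚ_ (E≡mean s) (E≡mean (s + r))) ⟩
    joint s r - mean s *ℚ mean (s + r)                 ≡⟨ covariance-formula s r ⟩
    pow y r *ℚ varₙ n *ℚ (1ℚ - pow y (2 * s))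
      ≡⟨ cong₂ (λ u w → u *ℚ varₙ n *ℚ (1ℚ - w)) (sym (1/^ b r)) (sym (1/^ b (2 * s))) ⟩
    invPow b r *ℚ varₙ n *ℚ (1ℚ - invPow b (2 * s))    ∎

proposition3p4 : (b n : ℕ) → .{{_ : NonZero b}} → 2 ≤ b → 2 ≤ n →
    (r s : ℕ) →
      (E b n r ≡ (1ℚ - invPow b r) *ℚ ((+ (n ∸ 1)) / 2))
    × (Var b n r ≡ (1ℚ - invPow b (2 * r)) *ℚ ((+ (n + 1)) / 12))
    × (Cov b n s r ≡ invPow b r *ℚ ((+ (n + 1)) / 12) *ℚ (1ℚ - invPow b (2 * s)))
proposition3p4 b n _ 2≤n r s = expectation r , variance r , covariance s r
  where open CarriesChain b n 2≤n
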